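{- Let $\mathbf{X}$ be any one of the logics $\mathbf{E}$, $\mathbf{E}\oplus N$, $\mathbf{E}\oplus M$, $\mathbf{E}\oplus M\oplus N$, $\mathbf{E}\oplus M\oplus C$, $\mathbf{E}\oplus M\oplus C\oplus N$, $\mathbf{E}\oplus D^\bot$, $\mathbf{E}\oplus N\oplus D^\bot$, $\mathbf{E}\oplus D^\Diamond$, $\mathbf{E}\oplus D^\bot\oplus D^\Diamond$, $\mathbf{E}\oplus N\oplus D^\bot\oplus D^\Diamond$, $\mathbf{E}\oplus M\oplus D^\bot$, $\mathbf{E}\oplus M\oplus N\oplus D^\bot$, $\mathbf{E}\oplus M\oplus D^\bot\oplus D^\Diamond$, $\mathbf{E}\oplus M\oplus N\oplus D^\bot\oplus D^\Diamond$, $\mathbf{E}\oplus M\oplus C\oplus D^\bot\oplus D^\Diamond$, $\mathbf{E}\oplus M\oplus C\oplus N\oplus D^\bot\oplus D^\Diamond$ (i.e. any logic in this family other than $\mathbf{E}\oplus C$, $\mathbf{E}\oplus C\oplus N$ and their deontic extensions). If $A\supset B$ is a theorem of $\mathbf{X}$, then there is a formula $I$ all of whose propositional variables occur in both $A$ and $B$ such that both $A\supset I$ and $I\supset B$ are theorems of $\mathbf{X}$.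
   Context: Formulas are generated from countably many propositional variables $p_0,p_1,\dots$ and the $0$-ary constant $\bot$ by the binary connectives $\wedge,\vee,\supset$ and the unary operator $\Box$ (so a formula may contain no propositional variable at all, e.g. $\bot$); $\neg A:=A\supset\bot$, $\top:=\bot\supset\bot$, $A\leftrightarrow B:=(A\supset B)\wedge(B\supset A)$, $\Diamond A:=\neg\Box\neg A$. Axiomatic systems: $\mathbf{L}$ has as axioms all instances (in this language) of propositional tautologies and modus ponens as its rule; $\mathbf{E}$ is $\mathbf{L}$ plus the rule $RE$: from $A\leftrightarrow B$ infer $\Box A\leftrightarrow\Box B$. Axiom schemes: $M$: $\Box(A\wedge B)\supset(\Box A\wedge\Box B)$; $C$: $(\Box A\wedge\Box B)\supset\Box(A\wedge B)$; $N$: $\Box\top$; $D^\bot$: $\neg\Box\bot$; $D^\Diamond$: $\Box A\supset\Diamond A$. $\mathbf{E}\oplus S_1\oplus\dots\oplus S_k$ denotes the extension of $\mathbf{E}$ by all instances of the schemes $S_1,\dots,S_k$ as axioms (closed under modus ponens and $RE$). -}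

module Defs where

open import Data.Nat using (ℕ)
open import Data.Bool using (Bool; true; false; _∧_; _∨_; not)
open import Data.List using (List; []; _∷_)
open import Data.List.Membership.Propositional using (_∈_)
open import Data.Product using (Σ; _×_; _,_)
open import Data.Sum using (_⊎_)
open import Data.Empty using (⊥)
open import Relation.Binary.PropositionalEquality using (_≡_)

infixr 5 _⊃_
infixl 7 _∧̇_
infixl 6 _∨̇_

data Fm : Set where
  var  : ℕ → Fm
  ⊥̇    : Fm
  _∧̇_  : Fm → Fm → Fm
  _∨̇_  : Fm → Fm → Fm
  _⊃_  : Fm → Fm → Fm
  □    : Fm → Fm

¬̇_ : Fm → Fm
¬̇ A = A ⊃ ⊥̇

⊤̇ : Fm
⊤̇ = ⊥̇ ⊃ ⊥̇

_⇔_ : Fm → Fm → Fm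
A ⇔ B = (A ⊃ B) ∧̇ (B ⊃ A)

◇ : Fm → Fm
◇ A = ¬̇ (□ (¬̇ A))

data PFm : Set where
  pvar : ℕ → PFm
  p⊥   : PFm
  _p∧_ : PFm → PFm → PFm
  _p∨_ : PFm → PFm → PFm
  _p⊃_ : PFm → PFm → PFm

eval : (ℕ → Bool) → PFm → Bool
eval v (pvar n) = v n
eval v p⊥ = false
eval v (a p∧ b) = eval v a ∧ eval v b
eval v (a p∨ b) = eval v a ∨ eval v b
eval v (a p⊃ b) = not (eval v a) ∨ eval v b

Tautology : PFm → Set
Tautology φ = ∀ (v : ℕ → Bool) → eval v φ ≡ true

subst : (ℕ → Fm) → PFm → Fm
subst σ (pvar n) = σ n
subst σ p⊥ = ⊥̇
subst σ (a p∧ b) = subst σ a ∧̇ subst σ b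
subst σ (a p∨ b) = subst σ a ∨̇ subst σ b
subst σ (a p⊃ b) = subst σ a ⊃ subst σ b

TautInstance : Fm → Set
TautInstance F = Σ PFm λ φ → Σ (ℕ → Fm) λ σ → Tautology φ × (subst σ φ ≡ F)

data Scheme : Set where
  M C N D⊥ D◇ : Scheme

Instance : Scheme → Fm → Set
Instance M  F = Σ Fm λ A → Σ Fm λ B → F ≡ (□ (A ∧̇ B) ⊃ (□ A ∧̇ □ B))
Instance C  F = Σ Fm λ A → Σ Fm λ B → F ≡ ((□ A ∧̇ □ B) ⊃ □ (A ∧̇ B))
Instance N  F = F ≡ □ ⊤̇
Instance D⊥ F = F ≡ ¬̇ (□ ⊥̇)
Instance D◇ F = Σ Fm λ A → F ≡ (□ A ⊃ ◇ A)

-- E ⊕ S₁ ⊕ … ⊕ Sₖ, given by its list of extra schemes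
data Thm (Ss : List Scheme) : Fm → Set where
  taut : ∀ {F} → TautInstance F → Thm Ss F
  ax   : ∀ {S F} → S ∈ Ss → Instance S F → Thm Ss F
  mp   : ∀ {A B} → Thm Ss (A ⊃ B) → Thm Ss A → Thm Ss B
  re   : ∀ {A B} → Thm Ss (A ⇔ B) → Thm Ss (□ A ⇔ □ B)

data Logic : Set where
  E E-N E-M E-MN E-MC E-MCN E-D⊥ E-ND⊥ E-D◇ E-D⊥D◇ E-ND⊥D◇
    E-MD⊥ E-MND⊥ E-MD⊥D◇ E-MND⊥D◇ E-MCD⊥D◇ E-MCND⊥D◇ : Logic

schemes : Logic → List Scheme
schemes E = []
schemes E-N = N ∷ []
schemes E-M = M ∷ []
schemes E-MN = M ∷ N ∷ []
schemes E-MC = M ∷ C ∷ []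
schemes E-MCN = M ∷ C ∷ N ∷ []
schemes E-D⊥ = D⊥ ∷ []
schemes E-ND⊥ = N ∷ D⊥ ∷ []
schemes E-D◇ = D◇ ∷ []
schemes E-D⊥D◇ = D⊥ ∷ D◇ ∷ []
schemes E-ND⊥D◇ = N ∷ D⊥ ∷ D◇ ∷ []
schemes E-MD⊥ = M ∷ D⊥ ∷ []
schemes E-MND⊥ = M ∷ N ∷ D⊥ ∷ []
schemes E-MD⊥D◇ = M ∷ D⊥ ∷ D◇ ∷ []
schemes E-MND⊥D◇ = M ∷ N ∷ D⊥ ∷ D◇ ∷ []
schemes E-MCD⊥D◇ = M ∷ C ∷ D⊥ ∷ D◇ ∷ []
schemes E-MCND⊥D◇ = M ∷ C ∷ N ∷ D⊥ ∷ D◇ ∷ []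

_⊢_ : Logic → Fm → Set
X ⊢ F = Thm (schemes X) F

data Occurs (n : ℕ) : Fm → Set where
  here : Occurs n (var n)
  ∧l : ∀ {A B} → Occurs n A → Occurs n (A ∧̇ B)
  ∧r : ∀ {A B} → Occurs n B → Occurs n (A ∧̇ B)
  ∨l : ∀ {A B} → Occurs n A → Occurs n (A ∨̇ B)
  ∨r : ∀ {A B} → Occurs n B → Occurs n (A ∨̇ B)
  ⊃l : ∀ {A B} → Occurs n A → Occurs n (A ⊃ B)
  ⊃r : ∀ {A B} → Occurs n B → Occurs n (A ⊃ B)
  in□ : ∀ {A} → Occurs n A → Occurs n (□ A)

module Submission where

open import Defs
open import Data.Nat using (ℕ; zero; suc; _<_; _≤_; _+_)
open import Data.Nat.Properties using (_≟_; ≤-refl; ≤-pred; ≤∧≢⇒<; m≤m+n; m≤n+m; <-≤-trans; <-irrefl; m<n⇒m<1+n)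
open import Data.Bool using (Bool; true; false; not; _∧_; _∨_)
open import Data.Bool.Properties using (∧-conicalˡ; ∧-conicalʳ)
open import Data.Unit using (⊤; tt)
open import Data.Empty using (⊥; ⊥-elim)
open import Data.List using (List; []; _∷_; _++_; length)
open import Data.List.Membership.Propositional using (_∈_; lose)
open import Data.List.Membership.Propositional.Properties using (∈-++⁺ˡ; ∈-++⁺ʳ)
open import Data.List.Relation.Unary.Any using (Any; here; there)
open import Data.List.Relation.Unary.All using (All; []; _∷_)
import Data.List.Relation.Unary.All as All
open import Data.List.Relation.Unary.All.Properties using (++⁺)
open import Data.List.Relation.Binary.Subset.Propositional using (_⊆_)
open import Data.List.Relation.Binary.Subset.Propositional.Properties using (⊆-refl)
open import Data.Product using (Σ; _×_; _,_; proj₁; proj₂; map₁; map₂)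
open import Data.Sum using (_⊎_; inj₁; inj₂)
import Data.Sum as Sum
open import Function using (id; _∘_)
open import Relation.Nullary using (does; yes; no; map′)
open import Relation.Binary.Definitions using (DecidableEquality)
open import Relation.Binary.PropositionalEquality using (_≡_; refl; sym; trans; cong; cong₂; subst₂)

-- Proof of the Craig interpolation theorem by Maehara's method.
--
-- For each logic L we define a cut-free sequent calculus  L ⊩ Γ ⇒ Δ  whose sequents are pairs
-- of lists read as sets (rules refer to formulas by membership, so contraction and exchange are
-- built in).  Besides the classical propositional rules it has one modal rule for each
-- combination of the axioms M, C, N, D⊥, D◇ present in L.  The argument has four parts.
--  * Cut admissibility (by induction on the cut formula, then on the two derivations).
--  * Completeness: every theorem of the Hilbert system is derivable; tautologies by Kalmár's
--    lemma, axioms directly, modus ponens and RE with the help of cut.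
--  * Soundness: a derivable sequent Γ ⇒ Δ gives the theorem ⋀Γ ⊃ ⋁Δ; the propositional
--    reasoning uses tautologies certified by a truth-table decision procedure.
--  * Maehara's lemma: for every partition of a derivable sequent into Γ₁;Γ₂ ⇒ Δ₁;Δ₂ there is an
--    interpolant I with Γ₁ ⇒ I,Δ₁ and I,Γ₂ ⇒ Δ₂ whose variables occur on both sides.  The
--    modal rules are where the choice of logic matters: for the listed logics every split
--    modal inference is again obtained from modal inferences of the same calculus.
-- The theorem follows by interpolating  A ⇒ B  with A on the left side and B on the right.

schemeCode : Scheme → ℕ
schemeCode M = 0
schemeCode C = 1
schemeCode N = 2
schemeCode D⊥ = 3
schemeCode D◇ = 4

schemeOfCode : ℕ → Scheme
schemeOfCode 0 = M
schemeOfCode 1 = C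
schemeOfCode 2 = N
schemeOfCode 3 = D⊥
schemeOfCode _ = D◇

schemeOfCode-code : ∀ S → schemeOfCode (schemeCode S) ≡ S
schemeOfCode-code M = refl
schemeOfCode-code C = refl
schemeOfCode-code N = refl
schemeOfCode-code D⊥ = refl
schemeOfCode-code D◇ = refl

_≟S_ : DecidableEquality Scheme
S ≟S S' = map′ codeInjective (cong schemeCode) (schemeCode S ≟ schemeCode S')
  where
  codeInjective : schemeCode S ≡ schemeCode S' → S ≡ S'
  codeInjective e = trans (sym (schemeOfCode-code S))
                          (trans (cong schemeOfCode e) (schemeOfCode-code S'))

open import Data.List.Membership.DecPropositional _≟S_ using (_∈?_)

has : Scheme → Logic → Bool
has S L = does (S ∈? schemes L)

has-sound : ∀ {S L} → has S L ≡ true → S ∈ schemes L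
has-sound {S} {L} e with S ∈? schemes L
... | yes m = m

has-complete : ∀ {S L} → S ∈ schemes L → has S L ≡ true
has-complete {S} {L} m with S ∈? schemes L
... | yes _ = refl
... | no ¬m = ⊥-elim (¬m m)

flagClash : ∀ {X : Set} {b : Bool} → b ≡ false → b ≡ true → X
flagClash refl ()

-- In every logic of the family C comes with M (E ⊕ C itself is excluded).
C⇒M : ∀ L → has C L ≡ true → has M L ≡ true
C⇒M E ()
C⇒M E-N ()
C⇒M E-M ()
C⇒M E-MN ()
C⇒M E-MC _ = refl
C⇒M E-MCN _ = refl
C⇒M E-D⊥ ()
C⇒M E-ND⊥ ()
C⇒M E-D◇ ()
C⇒M E-D⊥D◇ ()
C⇒M E-ND⊥D◇ ()
C⇒M E-MD⊥ ()
C⇒M E-MND⊥ ()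
C⇒M E-MD⊥D◇ ()
C⇒M E-MND⊥D◇ ()
C⇒M E-MCD⊥D◇ _ = refl
C⇒M E-MCND⊥D◇ _ = refl

noCwithoutM : ∀ {L} {X : Set} → has M L ≡ false → has C L ≡ true → X
noCwithoutM {L} m c = flagClash m (C⇒M L c)

-- Every logic containing D◇ together with N or C also contains D⊥ (the deontic rules rely
-- on this when a premise □A is replaced by □⊤ or by a conjunction of boxes).
D◇⇒D⊥ : ∀ L → has D◇ L ≡ true → has N L ≡ true ⊎ has C L ≡ true → has D⊥ L ≡ true
D◇⇒D⊥ E ()
D◇⇒D⊥ E-N ()
D◇⇒D⊥ E-M ()
D◇⇒D⊥ E-MN ()
D◇⇒D⊥ E-MC ()
D◇⇒D⊥ E-MCN ()
D◇⇒D⊥ E-D⊥ _ _ = refl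
D◇⇒D⊥ E-ND⊥ _ _ = refl
D◇⇒D⊥ E-D◇ _ (inj₁ ())
D◇⇒D⊥ E-D◇ _ (inj₂ ())
D◇⇒D⊥ E-D⊥D◇ _ _ = refl
D◇⇒D⊥ E-ND⊥D◇ _ _ = refl
D◇⇒D⊥ E-MD⊥ _ _ = refl
D◇⇒D⊥ E-MND⊥ _ _ = refl
D◇⇒D⊥ E-MD⊥D◇ _ _ = refl
D◇⇒D⊥ E-MND⊥D◇ _ _ = refl
D◇⇒D⊥ E-MCD⊥D◇ _ _ = refl
D◇⇒D⊥ E-MCND⊥D◇ _ _ = refl

-- Nonemptiness of a list of formulas (the C-rule needs N to have an empty premise list).
data NonEmpty : List Fm → Set where
  nonEmpty : ∀ {x xs} → NonEmpty (x ∷ xs)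

-- Each rule names its principal formula(s) by membership in the
-- conclusion, so Γ and Δ behave as sets.  The modal rules, one family per combination of
-- axioms, are collected in ModalRule; their conclusions may contain arbitrary further
-- formulas (built-in weakening).
infix 3 _⊩_⇒_

data _⊩_⇒_ (L : Logic) : List Fm → List Fm → Set
data ModalRule (L : Logic) : List Fm → List Fm → Set

data _⊩_⇒_ L where
  ax  : ∀ {Γ Δ n} → var n ∈ Γ → var n ∈ Δ → L ⊩ Γ ⇒ Δ
  ax⊥ : ∀ {Γ Δ} → ⊥̇ ∈ Γ → L ⊩ Γ ⇒ Δ
  ∧L : ∀ {Γ Δ A B} → (A ∧̇ B) ∈ Γ → L ⊩ A ∷ B ∷ Γ ⇒ Δ → L ⊩ Γ ⇒ Δ
  ∧R : ∀ {Γ Δ A B} → (A ∧̇ B) ∈ Δ → L ⊩ Γ ⇒ A ∷ Δ → L ⊩ Γ ⇒ B ∷ Δ → L ⊩ Γ ⇒ Δ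
  ∨L : ∀ {Γ Δ A B} → (A ∨̇ B) ∈ Γ → L ⊩ A ∷ Γ ⇒ Δ → L ⊩ B ∷ Γ ⇒ Δ → L ⊩ Γ ⇒ Δ
  ∨R : ∀ {Γ Δ A B} → (A ∨̇ B) ∈ Δ → L ⊩ Γ ⇒ A ∷ B ∷ Δ → L ⊩ Γ ⇒ Δ
  ⊃L : ∀ {Γ Δ A B} → (A ⊃ B) ∈ Γ → L ⊩ Γ ⇒ A ∷ Δ → L ⊩ B ∷ Γ ⇒ Δ → L ⊩ Γ ⇒ Δ
  ⊃R : ∀ {Γ Δ A B} → (A ⊃ B) ∈ Δ → L ⊩ A ∷ Γ ⇒ B ∷ Δ → L ⊩ Γ ⇒ Δ
  mod : ∀ {Γ Δ} → ModalRule L Γ Δ → L ⊩ Γ ⇒ Δ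

Boxed : List Fm → List Fm → Set
Boxed Γ As = All (λ a → □ a ∈ Γ) As

data ModalRule L where
  rE : ∀ {Γ Δ A B} → has M L ≡ false → □ A ∈ Γ → □ B ∈ Δ →
       L ⊩ A ∷ [] ⇒ B ∷ [] → L ⊩ B ∷ [] ⇒ A ∷ [] → ModalRule L Γ Δ
  rM : ∀ {Γ Δ A B} → has M L ≡ true → has C L ≡ false → □ A ∈ Γ → □ B ∈ Δ →
       L ⊩ A ∷ [] ⇒ B ∷ [] → ModalRule L Γ Δ
  rC : ∀ {Γ Δ B} (As : List Fm) → has C L ≡ true → (has N L ≡ true ⊎ NonEmpty As) →
       Boxed Γ As → □ B ∈ Δ → L ⊩ As ⇒ B ∷ [] → ModalRule L Γ Δ
  rN : ∀ {Γ Δ B} → has N L ≡ true → has C L ≡ false → □ B ∈ Δ → L ⊩ [] ⇒ B ∷ [] → ModalRule L Γ Δ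
  rD : ∀ {Γ Δ A} → has D⊥ L ≡ true → has C L ≡ false → □ A ∈ Γ → L ⊩ A ∷ [] ⇒ [] → ModalRule L Γ Δ
  rDE : ∀ {Γ Δ A B} → has D◇ L ≡ true → has M L ≡ false → □ A ∈ Γ → □ B ∈ Γ →
        L ⊩ [] ⇒ A ∷ B ∷ [] → L ⊩ A ∷ B ∷ [] ⇒ [] → ModalRule L Γ Δ
  rDM : ∀ {Γ Δ A B} → has D◇ L ≡ true → has M L ≡ true → has C L ≡ false → □ A ∈ Γ → □ B ∈ Γ →
        L ⊩ A ∷ B ∷ [] ⇒ [] → ModalRule L Γ Δ
  rCD : ∀ {Γ Δ} (As : List Fm) → has C L ≡ true → has D⊥ L ≡ true → NonEmpty As →
        Boxed Γ As → L ⊩ As ⇒ [] → ModalRule L Γ Δ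

⊆-keep : ∀ {A : Fm} {Γ Δ} → Γ ⊆ Δ → A ∷ Γ ⊆ A ∷ Δ
⊆-keep s (here p) = here p
⊆-keep s (there m) = there (s m)

⊆-head : ∀ {X : Fm} {Y} → X ∷ [] ⊆ X ∷ Y
⊆-head (here p) = here p

⊆-[] : ∀ {Γ : List Fm} → [] ⊆ Γ
⊆-[] ()

⊆-pick₁ : ∀ {a b c : Fm} {Δ} → a ∷ Δ ⊆ a ∷ b ∷ c ∷ Δ
⊆-pick₁ (here r) = here r
⊆-pick₁ (there x) = there (there (there x))

⊆-pick₂ : ∀ {a b c : Fm} {Δ} → b ∷ Δ ⊆ a ∷ b ∷ c ∷ Δ
⊆-pick₂ (here r) = there (here r)
⊆-pick₂ (there x) = there (there (there x))

⊆-swap : ∀ {A B : Fm} {Γ} → A ∷ B ∷ Γ ⊆ B ∷ A ∷ Γ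
⊆-swap (here p) = there (here p)
⊆-swap (there (here p)) = here p
⊆-swap (there (there x)) = there (there x)

-- Weakening is admissible (and with it contraction and exchange, as sequents are sets); a
-- modal rule only inspects the boxed formulas of its antecedent.
wkModal : ∀ {L Γ Δ Γ' Δ'} → ModalRule L Γ Δ → (∀ {a} → □ a ∈ Γ → □ a ∈ Γ') → Δ ⊆ Δ' → ModalRule L Γ' Δ'
wkModal (rE a m1 m2 p q) g d = rE a (g m1) (d m2) p q
wkModal (rM a b m1 m2 p) g d = rM a b (g m1) (d m2) p
wkModal (rC As a b al m2 p) g d = rC As a b (All.map g al) (d m2) p
wkModal (rN a b m2 p) g d = rN a b (d m2) p
wkModal (rD a b m1 p) g d = rD a b (g m1) p
wkModal (rDE a b m1 m2 p q) g d = rDE a b (g m1) (g m2) p q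
wkModal (rDM a b c m1 m2 p) g d = rDM a b c (g m1) (g m2) p
wkModal (rCD As a b n al p) g d = rCD As a b n (All.map g al) p

wk : ∀ {L Γ Δ Γ' Δ'} → L ⊩ Γ ⇒ Δ → Γ ⊆ Γ' → Δ ⊆ Δ' → L ⊩ Γ' ⇒ Δ'
wk (ax m1 m2) g d = ax (g m1) (d m2)
wk (ax⊥ m) g d = ax⊥ (g m)
wk (∧L m p) g d = ∧L (g m) (wk p (⊆-keep (⊆-keep g)) d)
wk (∧R m p q) g d = ∧R (d m) (wk p g (⊆-keep d)) (wk q g (⊆-keep d))
wk (∨L m p q) g d = ∨L (g m) (wk p (⊆-keep g) d) (wk q (⊆-keep g) d)
wk (∨R m p) g d = ∨R (d m) (wk p g (⊆-keep (⊆-keep d)))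
wk (⊃L m p q) g d = ⊃L (g m) (wk p g (⊆-keep d)) (wk q (⊆-keep g) d)
wk (⊃R m p) g d = ⊃R (d m) (wk p (⊆-keep g) (⊆-keep d))
wk (mod r) g d = mod (wkModal r g d)

monoRule : ∀ {L Γ Δ A B} → has M L ≡ true → □ A ∈ Γ → □ B ∈ Δ → L ⊩ A ∷ [] ⇒ B ∷ [] → L ⊩ Γ ⇒ Δ
monoRule {L} e m1 m2 p with has C L in c
... | false = mod (rM e c m1 m2 p)
... | true = mod (rC (_ ∷ []) c (inj₂ nonEmpty) (m1 ∷ []) m2 p)

eqRule : ∀ {L Γ Δ A B} → □ A ∈ Γ → □ B ∈ Δ → L ⊩ A ∷ [] ⇒ B ∷ [] → L ⊩ B ∷ [] ⇒ A ∷ [] → L ⊩ Γ ⇒ Δ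
eqRule {L} m1 m2 p q with has M L in e
... | false = mod (rE e m1 m2 p q)
... | true = monoRule e m1 m2 p

identity : ∀ {L Γ Δ} F → F ∈ Γ → F ∈ Δ → L ⊩ Γ ⇒ Δ
identity (var n) m1 m2 = ax m1 m2
identity ⊥̇ m1 m2 = ax⊥ m1
identity (A ∧̇ B) m1 m2 =
  ∧L m1 (∧R m2 (identity A (here refl) (here refl)) (identity B (there (here refl)) (here refl)))
identity (A ∨̇ B) m1 m2 =
  ∨R m2 (∨L m1 (identity A (here refl) (here refl)) (identity B (here refl) (there (here refl))))
identity (A ⊃ B) m1 m2 =
  ⊃R m2 (⊃L (there m1) (identity A (here refl) (here refl)) (identity B (here refl) (here refl)))
identity (□ A) m1 m2 = eqRule m1 m2 (identity A (here refl) (here refl)) (identity A (here refl) (here refl))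

CutAdmissible : Logic → Fm → Set
CutAdmissible L A = ∀ {Γ1 Δ1 Γ2 Δ2 Γ Δ} → L ⊩ Γ1 ⇒ Δ1 → L ⊩ Γ2 ⇒ Δ2 →
  Γ1 ⊆ Γ → Γ2 ⊆ A ∷ Γ → Δ1 ⊆ A ∷ Δ → Δ2 ⊆ Δ → L ⊩ Γ ⇒ Δ

-- The induction hypothesis of cut elimination: cut is admissible for the immediate subformulas.
CutBelow : Logic → Fm → Set
CutBelow L (var n) = ⊤
CutBelow L ⊥̇ = ⊤
CutBelow L (A ∧̇ B) = CutAdmissible L A × CutAdmissible L B
CutBelow L (A ∨̇ B) = CutAdmissible L A × CutAdmissible L B
CutBelow L (A ⊃ B) = CutAdmissible L A × CutAdmissible L B
CutBelow L (□ A) = CutAdmissible L A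

⊆-under : ∀ {A B : Fm} {Γ2 Γ} → Γ2 ⊆ A ∷ Γ → B ∷ Γ2 ⊆ A ∷ B ∷ Γ
⊆-under g (here p) = there (here p)
⊆-under g (there m) with g m
... | here p = here p
... | there m' = there (there m')

⊆-under₂ : ∀ {A B : Fm} {Δ1 Δ} → Δ1 ⊆ A ∷ Δ → Δ1 ⊆ A ∷ B ∷ Δ
⊆-under₂ d x = ⊆-keep there (d x)

⊆-drop : ∀ {A : Fm} {Γ x} → x ∈ A ∷ Γ → A ∈ Γ → x ∈ Γ
⊆-drop (here refl) a = a
⊆-drop (there m) a = m

dropNonBox : ∀ {a G} {Γ : List Fm} → (□ a ≡ G → ⊥) → □ a ∈ G ∷ Γ → □ a ∈ Γ
dropNonBox notBox (here e) = ⊥-elim (notBox e)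
dropNonBox notBox (there m) = m

-- The ways □G can be introduced on the right by a modal rule with side premises in Γ; a
-- cut on □G whose left premise ends in such a rule is resolved with the data stored here.
data BoxRight (L : Logic) (Γ : List Fm) (G : Fm) : Set where
  bE : ∀ {A} → has M L ≡ false → □ A ∈ Γ → L ⊩ A ∷ [] ⇒ G ∷ [] → L ⊩ G ∷ [] ⇒ A ∷ [] → BoxRight L Γ G
  bM : ∀ {A} → has M L ≡ true → has C L ≡ false → □ A ∈ Γ → L ⊩ A ∷ [] ⇒ G ∷ [] → BoxRight L Γ G
  bC : (As : List Fm) → has C L ≡ true → (has N L ≡ true ⊎ NonEmpty As) →
       Boxed Γ As → L ⊩ As ⇒ G ∷ [] → BoxRight L Γ G
  bN : has N L ≡ true → has C L ≡ false → L ⊩ [] ⇒ G ∷ [] → BoxRight L Γ G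

wkBoxRight : ∀ {L Γ Γ' G} → BoxRight L Γ G → Γ ⊆ Γ' → BoxRight L Γ' G
wkBoxRight (bE a m p q) g = bE a (g m) p q
wkBoxRight (bM a b m p) g = bM a b (g m) p
wkBoxRight (bC As a b al p) g = bC As a b (All.map g al) p
wkBoxRight (bN a b p) g = bN a b p

splitOff : ∀ {G Γ As} → Boxed (□ G ∷ Γ) As → Σ (List Fm) λ K → Boxed Γ K × (As ⊆ G ∷ K)
splitOff [] = [] , [] , λ ()
splitOff (here refl ∷ al) with splitOff al
... | K , alK , s = K , alK , λ { (here p) → here p ; (there x) → s x }
splitOff {G} (_∷_ {a} (there m) al) with splitOff al
... | K , alK , s = (a ∷ K) , (m ∷ alK) , λ { (here p) → there (here p) ; (there x) → shift (s x) }
  where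
  shift : ∀ {y} → y ∈ G ∷ K → y ∈ G ∷ a ∷ K
  shift (here p) = here p
  shift (there q) = there (there q)

allowed++ : ∀ {L} {Cs K : List Fm} → (has N L ≡ true ⊎ NonEmpty Cs) → (has N L ≡ true ⊎ NonEmpty (Cs ++ K))
allowed++ (inj₁ n) = inj₁ n
allowed++ (inj₂ nonEmpty) = inj₂ nonEmpty

deonticC : ∀ {L Γ Δ} → has C L ≡ true → has D⊥ L ≡ true → (Bs : List Fm) → Boxed Γ Bs →
  L ⊩ Bs ⇒ [] → L ⊩ Γ ⇒ Δ
deonticC c d [] al R = wk R ⊆-[] ⊆-[]
deonticC c d (x ∷ xs) al R = mod (rCD (x ∷ xs) c d nonEmpty al R)

-- The left premise introduced □G (recorded in BoxRight) and the right
-- premise ends in a modal rule; if that rule uses □G, the two modal inferences merge into one,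
-- cutting G in their premises with the hypothesis ih.

⊆-skipMiddle : ∀ {X Y Z : Fm} {W} → X ∷ Y ∷ [] ⊆ X ∷ Z ∷ Y ∷ W
⊆-skipMiddle (here p) = here p
⊆-skipMiddle (there (here p)) = there (there (here p))

⊆-prefix₂ : ∀ {X Y : Fm} {W} → X ∷ Y ∷ [] ⊆ X ∷ Y ∷ W
⊆-prefix₂ (here p) = here p
⊆-prefix₂ (there (here p)) = there (here p)

⊆-swapPrefix : ∀ {X Y : Fm} {W} → X ∷ Y ∷ [] ⊆ Y ∷ X ∷ W
⊆-swapPrefix (here p) = there (here p)
⊆-swapPrefix (there (here p)) = here p

⊆-second : ∀ {X Y : Fm} {W} → X ∷ [] ⊆ Y ∷ X ∷ W
⊆-second (here p) = there (here p)

⊆-contract : ∀ {X : Fm} {W} → X ∷ X ∷ [] ⊆ X ∷ W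
⊆-contract (here p) = here p
⊆-contract (there (here p)) = here p

cut□E : ∀ {L G Γ Δ A B} → CutAdmissible L G → BoxRight L Γ G → has M L ≡ false →
  □ A ∈ □ G ∷ Γ → □ B ∈ Δ → L ⊩ A ∷ [] ⇒ B ∷ [] → L ⊩ B ∷ [] ⇒ A ∷ [] → L ⊩ Γ ⇒ Δ
cut□E ih rb a (there ma) mb p q = mod (rE a ma mb p q)
cut□E ih (bE _ mc pc qc) a (here refl) mb p q =
  mod (rE a mc mb (ih pc p ⊆-refl ⊆-head ⊆-head ⊆-refl) (ih q qc ⊆-refl ⊆-head ⊆-head ⊆-refl))
cut□E ih (bM e _ _ _) a (here refl) mb p q = flagClash a e
cut□E {L} ih (bC _ c _ _ _) a (here refl) mb p q = noCwithoutM {L} a c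
cut□E ih (bN n c pc) a (here refl) mb p q = mod (rN n c mb (ih pc p ⊆-[] ⊆-head ⊆-head ⊆-refl))

cut□M : ∀ {L G Γ Δ A B} → CutAdmissible L G → BoxRight L Γ G → has M L ≡ true → has C L ≡ false →
  □ A ∈ □ G ∷ Γ → □ B ∈ Δ → L ⊩ A ∷ [] ⇒ B ∷ [] → L ⊩ Γ ⇒ Δ
cut□M ih rb a c (there ma) mb p = mod (rM a c ma mb p)
cut□M ih (bE e _ _ _) a c (here refl) mb p = flagClash e a
cut□M ih (bM _ _ mc pc) a c (here refl) mb p = mod (rM a c mc mb (ih pc p ⊆-refl ⊆-head ⊆-head ⊆-refl))
cut□M ih (bC _ c' _ _ _) a c (here refl) mb p = flagClash c c'
cut□M ih (bN n _ pc) a c (here refl) mb p = mod (rN n c mb (ih pc p ⊆-[] ⊆-head ⊆-head ⊆-refl))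

cut□D : ∀ {L G Γ Δ A} → CutAdmissible L G → BoxRight L Γ G → has D⊥ L ≡ true → has C L ≡ false →
  □ A ∈ □ G ∷ Γ → L ⊩ A ∷ [] ⇒ [] → L ⊩ Γ ⇒ Δ
cut□D ih rb d c (there ma) p = mod (rD d c ma p)
cut□D ih (bE _ mc pc _) d c (here refl) p = mod (rD d c mc (ih pc p ⊆-refl ⊆-head ⊆-head ⊆-[]))
cut□D ih (bM _ _ mc pc) d c (here refl) p = mod (rD d c mc (ih pc p ⊆-refl ⊆-head ⊆-head ⊆-[]))
cut□D ih (bC _ c' _ _ _) d c (here refl) p = flagClash c c'
cut□D ih (bN n _ pc) d c (here refl) p = wk (ih pc p ⊆-[] ⊆-head ⊆-head ⊆-[]) ⊆-[] ⊆-[]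

-- In the D◇ cases one of the two boxes may be □⊤-like (from N); then the D⊥-rule applies.
cut□DE : ∀ {L G Γ Δ A B} → CutAdmissible L G → BoxRight L Γ G → has D◇ L ≡ true → has M L ≡ false →
  □ A ∈ □ G ∷ Γ → □ B ∈ □ G ∷ Γ → L ⊩ [] ⇒ A ∷ B ∷ [] → L ⊩ A ∷ B ∷ [] ⇒ [] → L ⊩ Γ ⇒ Δ
cut□DE ih rb d e (there ma) (there mb) p q = mod (rDE d e ma mb p q)
cut□DE ih (bM e' _ _ _) d e (here refl) _ p q = flagClash e e'
cut□DE {L} ih (bC _ c _ _ _) d e (here refl) _ p q = noCwithoutM {L} e c
cut□DE ih (bM e' _ _ _) d e (there _) (here refl) p q = flagClash e e'
cut□DE {L} ih (bC _ c _ _ _) d e (there _) (here refl) p q = noCwithoutM {L} e c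
cut□DE {L} ih (bE _ mc pc qc) d e (here refl) (there mb) p q =
  mod (rDE d e mc mb (ih p qc ⊆-[] ⊆-head ⊆-skipMiddle ⊆-head) (ih pc q ⊆-head ⊆-skipMiddle ⊆-head ⊆-[]))
cut□DE {L} ih (bN n c pc) d e (here refl) (there mb) p q =
  mod (rD (D◇⇒D⊥ L d (inj₁ n)) c mb (ih pc q ⊆-[] ⊆-prefix₂ ⊆-head ⊆-[]))
cut□DE {L} ih (bE _ mc pc qc) d e (there ma) (here refl) p q =
  mod (rDE d e ma mc (ih p qc ⊆-[] ⊆-head ⊆-swapPrefix ⊆-second) (ih pc q ⊆-second ⊆-swapPrefix ⊆-head ⊆-[]))
cut□DE {L} ih (bN n c pc) d e (there ma) (here refl) p q =
  mod (rD (D◇⇒D⊥ L d (inj₁ n)) c ma (ih pc q ⊆-[] ⊆-swapPrefix ⊆-head ⊆-[]))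
cut□DE {L} ih (bE _ mc pc qc) d e (here refl) (here refl) p q =
  mod (rDE d e mc mc (ih p qc ⊆-[] ⊆-head ⊆-contract ⊆-head) (ih pc q ⊆-head ⊆-contract ⊆-head ⊆-[]))
cut□DE {L} ih (bN n c pc) d e (here refl) (here refl) p q =
  wk (ih pc q ⊆-[] ⊆-contract ⊆-head ⊆-[]) ⊆-[] ⊆-[]

cut□DM : ∀ {L G Γ Δ A B} → CutAdmissible L G → BoxRight L Γ G → has D◇ L ≡ true → has M L ≡ true →
  has C L ≡ false → □ A ∈ □ G ∷ Γ → □ B ∈ □ G ∷ Γ → L ⊩ A ∷ B ∷ [] ⇒ [] → L ⊩ Γ ⇒ Δ
cut□DM ih rb d m c (there ma) (there mb) q = mod (rDM d m c ma mb q)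
cut□DM ih (bE e _ _ _) d m c (here refl) _ q = flagClash e m
cut□DM ih (bC _ c' _ _ _) d m c (here refl) _ q = flagClash c c'
cut□DM ih (bE e _ _ _) d m c (there _) (here refl) q = flagClash e m
cut□DM ih (bC _ c' _ _ _) d m c (there _) (here refl) q = flagClash c c'
cut□DM ih (bM _ _ mc pc) d m c (here refl) (there mb) q =
  mod (rDM d m c mc mb (ih pc q ⊆-head ⊆-skipMiddle ⊆-head ⊆-[]))
cut□DM {L} ih (bN n _ pc) d m c (here refl) (there mb) q =
  mod (rD (D◇⇒D⊥ L d (inj₁ n)) c mb (ih pc q ⊆-[] ⊆-prefix₂ ⊆-head ⊆-[]))
cut□DM ih (bM _ _ mc pc) d m c (there ma) (here refl) q =
  mod (rDM d m c ma mc (ih pc q ⊆-second ⊆-swapPrefix ⊆-head ⊆-[]))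
cut□DM {L} ih (bN n _ pc) d m c (there ma) (here refl) q =
  mod (rD (D◇⇒D⊥ L d (inj₁ n)) c ma (ih pc q ⊆-[] ⊆-swapPrefix ⊆-head ⊆-[]))
cut□DM ih (bM _ _ mc pc) d m c (here refl) (here refl) q =
  mod (rDM d m c mc mc (ih pc q ⊆-head ⊆-contract ⊆-head ⊆-[]))
cut□DM ih (bN n _ pc) d m c (here refl) (here refl) q =
  wk (ih pc q ⊆-[] ⊆-contract ⊆-head ⊆-[]) ⊆-[] ⊆-[]

-- For the rules of logics with C the premise lists are merged: G is cut from As ⊆ G ∷ K
-- against Cs ⇒ G, leaving Cs ++ K.
mergePremises : ∀ {L G Cs As K Δ} → CutAdmissible L G → L ⊩ Cs ⇒ G ∷ [] → L ⊩ As ⇒ Δ →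
  As ⊆ G ∷ K → L ⊩ Cs ++ K ⇒ Δ
mergePremises {G = G} {Cs} {K = K} ih pc p s = ih pc p ∈-++⁺ˡ (λ x → shift (s x)) ⊆-head ⊆-refl
  where
  shift : ∀ {y} → y ∈ G ∷ K → y ∈ G ∷ (Cs ++ K)
  shift (here p) = here p
  shift (there q) = there (∈-++⁺ʳ Cs q)

cut□C : ∀ {L G Γ Δ As B} → CutAdmissible L G → BoxRight L Γ G → has C L ≡ true →
  (has N L ≡ true ⊎ NonEmpty As) → Boxed (□ G ∷ Γ) As → □ B ∈ Δ → L ⊩ As ⇒ B ∷ [] → L ⊩ Γ ⇒ Δ
cut□C {L} ih (bE e _ _ _) c ok al mb p = noCwithoutM {L} e c
cut□C ih (bM _ c' _ _) c ok al mb p = flagClash c' c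
cut□C ih (bN _ c' _) c ok al mb p = flagClash c' c
cut□C {L} ih (bC Cs _ okc alc pc) c ok al mb p with splitOff al
... | K , alK , s = mod (rC (Cs ++ K) c (allowed++ {L} okc) (++⁺ alc alK) mb (mergePremises ih pc p s))

cut□CD : ∀ {L G Γ Δ As} → CutAdmissible L G → BoxRight L Γ G → has C L ≡ true → has D⊥ L ≡ true →
  Boxed (□ G ∷ Γ) As → L ⊩ As ⇒ [] → L ⊩ Γ ⇒ Δ
cut□CD {L} ih (bE e _ _ _) c d al p = noCwithoutM {L} e c
cut□CD ih (bM _ c' _ _) c d al p = flagClash c' c
cut□CD ih (bN _ c' _) c d al p = flagClash c' c
cut□CD ih (bC Cs _ okc alc pc) c d al p with splitOff al
... | K , alK , s = deonticC c d (Cs ++ K) (++⁺ alc alK) (mergePremises ih pc p s)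

cutRight□Modal : ∀ {L G Γ Γ2 Δ Δ2} → CutAdmissible L G → BoxRight L Γ G → ModalRule L Γ2 Δ2 →
  Γ2 ⊆ □ G ∷ Γ → Δ2 ⊆ Δ → L ⊩ Γ ⇒ Δ
cutRight□Modal ih rb (rE a ma mb p q) g d = cut□E ih rb a (g ma) (d mb) p q
cutRight□Modal ih rb (rM a c ma mb p) g d = cut□M ih rb a c (g ma) (d mb) p
cutRight□Modal ih rb (rC As c ok al mb p) g d = cut□C ih rb c ok (All.map g al) (d mb) p
cutRight□Modal ih rb (rN n c mb p) g d = mod (rN n c (d mb) p)
cutRight□Modal ih rb (rD dd c ma p) g d = cut□D ih rb dd c (g ma) p
cutRight□Modal ih rb (rDE dd e ma mb p q) g d = cut□DE ih rb dd e (g ma) (g mb) p q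
cutRight□Modal ih rb (rDM dd m c ma mb q) g d = cut□DM ih rb dd m c (g ma) (g mb) q
cutRight□Modal ih rb (rCD As c dd n al p) g d = cut□CD ih rb c dd (All.map g al) p

-- Cut on □G whose left premise introduced □G: induction on the right premise up to the modal
-- rule that uses □G.
cutRight□ : ∀ {L G Γ Γ2 Δ Δ2} → CutAdmissible L G → BoxRight L Γ G → L ⊩ Γ2 ⇒ Δ2 →
  Γ2 ⊆ □ G ∷ Γ → Δ2 ⊆ Δ → L ⊩ Γ ⇒ Δ
cutRight□ ih rb (ax m1 m2) g2 d2 with g2 m1
... | there m = ax m (d2 m2)
cutRight□ ih rb (ax⊥ m) g2 d2 with g2 m
... | there m' = ax⊥ m'
cutRight□ ih rb (∧L m r) g2 d2 with g2 m
... | there m' = ∧L m' (cutRight□ ih (wkBoxRight rb (λ x → there (there x))) r (⊆-under (⊆-under g2)) d2)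
cutRight□ ih rb (∧R m r s) g2 d2 =
  ∧R (d2 m) (cutRight□ ih rb r g2 (⊆-keep d2)) (cutRight□ ih rb s g2 (⊆-keep d2))
cutRight□ ih rb (∨L m r s) g2 d2 with g2 m
... | there m' =
    ∨L m' (cutRight□ ih (wkBoxRight rb there) r (⊆-under g2) d2)
      (cutRight□ ih (wkBoxRight rb there) s (⊆-under g2) d2)
cutRight□ ih rb (∨R m r) g2 d2 = ∨R (d2 m) (cutRight□ ih rb r g2 (⊆-keep (⊆-keep d2)))
cutRight□ ih rb (⊃L m r s) g2 d2 with g2 m
... | there m' =
    ⊃L m' (cutRight□ ih rb r g2 (⊆-keep d2)) (cutRight□ ih (wkBoxRight rb there) s (⊆-under g2) d2)
cutRight□ ih rb (⊃R m r) g2 d2 = ⊃R (d2 m) (cutRight□ ih (wkBoxRight rb there) r (⊆-under g2) (⊆-keep d2))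
cutRight□ ih rb (mod r) g2 d2 = cutRight□Modal ih rb r g2 d2

cutLeftModal : ∀ {L A Γ1 Δ1 Γ2 Δ2 Γ Δ} → CutBelow L A → ModalRule L Γ1 Δ1 → L ⊩ Γ2 ⇒ Δ2 →
  Γ1 ⊆ Γ → Γ2 ⊆ A ∷ Γ → Δ1 ⊆ A ∷ Δ → Δ2 ⊆ Δ → L ⊩ Γ ⇒ Δ
cutLeftModal ih (rE a m1 m2 p q) D2 g1 g2 d1 d2 with d1 m2
... | here refl = cutRight□ ih (bE a (g1 m1) p q) D2 g2 d2
... | there m = mod (rE a (g1 m1) m p q)
cutLeftModal ih (rM a b m1 m2 p) D2 g1 g2 d1 d2 with d1 m2
... | here refl = cutRight□ ih (bM a b (g1 m1) p) D2 g2 d2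
... | there m = mod (rM a b (g1 m1) m p)
cutLeftModal ih (rC As a b al m2 p) D2 g1 g2 d1 d2 with d1 m2
... | here refl = cutRight□ ih (bC As a b (All.map g1 al) p) D2 g2 d2
... | there m = mod (rC As a b (All.map g1 al) m p)
cutLeftModal ih (rN a b m2 p) D2 g1 g2 d1 d2 with d1 m2
... | here refl = cutRight□ ih (bN a b p) D2 g2 d2
... | there m = mod (rN a b m p)
cutLeftModal ih (rD a b m1 p) D2 g1 g2 d1 d2 = mod (rD a b (g1 m1) p)
cutLeftModal ih (rDE a b m1 m2 p q) D2 g1 g2 d1 d2 = mod (rDE a b (g1 m1) (g1 m2) p q)
cutLeftModal ih (rDM a b c m1 m2 p) D2 g1 g2 d1 d2 = mod (rDM a b c (g1 m1) (g1 m2) p)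
cutLeftModal ih (rCD As a b n al p) D2 g1 g2 d1 d2 = mod (rCD As a b n (All.map g1 al) p)

cutWith : ∀ {L A Γ Δ} → CutAdmissible L A → L ⊩ Γ ⇒ A ∷ Δ → L ⊩ A ∷ Γ ⇒ Δ → L ⊩ Γ ⇒ Δ
cutWith h d1 d2 = h d1 d2 ⊆-refl ⊆-refl ⊆-refl ⊆-refl

-- Cut elimination for a fixed cut formula A, assuming it for the subformulas of A: induction on
-- the left premise until A becomes principal there, then (cutRight*) on the right premise
-- until it is principal there too, where the cut is replaced by cuts on subformulas.
cut : ∀ {L A} → CutBelow L A → CutAdmissible L A
cutRight∧ : ∀ {L B C Γ1 Δ1 Γ2 Δ2 Γ Δ} → CutBelow L (B ∧̇ C) →
  L ⊩ Γ1 ⇒ Δ1 → L ⊩ Γ1 ⇒ B ∷ Δ1 → L ⊩ Γ1 ⇒ C ∷ Δ1 → L ⊩ Γ2 ⇒ Δ2 →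
  Γ1 ⊆ Γ → Γ2 ⊆ (B ∧̇ C) ∷ Γ → Δ1 ⊆ (B ∧̇ C) ∷ Δ → Δ2 ⊆ Δ → L ⊩ Γ ⇒ Δ
cutRight∨ : ∀ {L B C Γ1 Δ1 Γ2 Δ2 Γ Δ} → CutBelow L (B ∨̇ C) →
  L ⊩ Γ1 ⇒ Δ1 → L ⊩ Γ1 ⇒ B ∷ C ∷ Δ1 → L ⊩ Γ2 ⇒ Δ2 →
  Γ1 ⊆ Γ → Γ2 ⊆ (B ∨̇ C) ∷ Γ → Δ1 ⊆ (B ∨̇ C) ∷ Δ → Δ2 ⊆ Δ → L ⊩ Γ ⇒ Δ
cutRight⊃ : ∀ {L B C Γ1 Δ1 Γ2 Δ2 Γ Δ} → CutBelow L (B ⊃ C) →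
  L ⊩ Γ1 ⇒ Δ1 → L ⊩ B ∷ Γ1 ⇒ C ∷ Δ1 → L ⊩ Γ2 ⇒ Δ2 →
  Γ1 ⊆ Γ → Γ2 ⊆ (B ⊃ C) ∷ Γ → Δ1 ⊆ (B ⊃ C) ∷ Δ → Δ2 ⊆ Δ → L ⊩ Γ ⇒ Δ

cutLeft∧R : ∀ {L A B C Γ1 Δ1 Γ2 Δ2 Γ Δ} → CutBelow L A →
  L ⊩ Γ1 ⇒ Δ1 → L ⊩ Γ1 ⇒ B ∷ Δ1 → L ⊩ Γ1 ⇒ C ∷ Δ1 → L ⊩ Γ2 ⇒ Δ2 →
  Γ1 ⊆ Γ → Γ2 ⊆ A ∷ Γ → Δ1 ⊆ A ∷ Δ → Δ2 ⊆ Δ → (B ∧̇ C) ∈ A ∷ Δ → L ⊩ Γ ⇒ Δ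
cutLeft∧R ih D1 p q D2 g1 g2 d1 d2 (here refl) = cutRight∧ ih D1 p q D2 g1 g2 d1 d2
cutLeft∧R ih D1 p q D2 g1 g2 d1 d2 (there m) =
  ∧R m (cut ih p D2 g1 g2 (⊆-under d1) (there ∘ d2)) (cut ih q D2 g1 g2 (⊆-under d1) (there ∘ d2))

cutLeft∨R : ∀ {L A B C Γ1 Δ1 Γ2 Δ2 Γ Δ} → CutBelow L A →
  L ⊩ Γ1 ⇒ Δ1 → L ⊩ Γ1 ⇒ B ∷ C ∷ Δ1 → L ⊩ Γ2 ⇒ Δ2 →
  Γ1 ⊆ Γ → Γ2 ⊆ A ∷ Γ → Δ1 ⊆ A ∷ Δ → Δ2 ⊆ Δ → (B ∨̇ C) ∈ A ∷ Δ → L ⊩ Γ ⇒ Δ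
cutLeft∨R ih D1 p D2 g1 g2 d1 d2 (here refl) = cutRight∨ ih D1 p D2 g1 g2 d1 d2
cutLeft∨R ih D1 p D2 g1 g2 d1 d2 (there m) =
  ∨R m (cut ih p D2 g1 g2 (⊆-under (⊆-under d1)) (there ∘ there ∘ d2))

cutLeft⊃R : ∀ {L A B C Γ1 Δ1 Γ2 Δ2 Γ Δ} → CutBelow L A →
  L ⊩ Γ1 ⇒ Δ1 → L ⊩ B ∷ Γ1 ⇒ C ∷ Δ1 → L ⊩ Γ2 ⇒ Δ2 →
  Γ1 ⊆ Γ → Γ2 ⊆ A ∷ Γ → Δ1 ⊆ A ∷ Δ → Δ2 ⊆ Δ → (B ⊃ C) ∈ A ∷ Δ → L ⊩ Γ ⇒ Δ
cutLeft⊃R ih D1 p D2 g1 g2 d1 d2 (here refl) = cutRight⊃ ih D1 p D2 g1 g2 d1 d2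
cutLeft⊃R ih D1 p D2 g1 g2 d1 d2 (there m) =
  ⊃R m (cut ih p D2 (⊆-keep g1) (⊆-under₂ g2) (⊆-under d1) (there ∘ d2))

cut ih (ax m1 m2) D2 g1 g2 d1 d2 with d1 m2
... | here refl = wk D2 (λ m → ⊆-drop (g2 m) (g1 m1)) d2
... | there m = ax (g1 m1) m
cut ih (ax⊥ m) D2 g1 g2 d1 d2 = ax⊥ (g1 m)
cut ih (∧L m p) D2 g1 g2 d1 d2 = ∧L (g1 m) (cut ih p D2 (⊆-keep (⊆-keep g1)) (⊆-under₂ (⊆-under₂ g2)) d1 d2)
cut ih D1@(∧R m p q) D2 g1 g2 d1 d2 = cutLeft∧R ih D1 p q D2 g1 g2 d1 d2 (d1 m)
cut ih (∨L m p q) D2 g1 g2 d1 d2 =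
  ∨L (g1 m) (cut ih p D2 (⊆-keep g1) (⊆-under₂ g2) d1 d2) (cut ih q D2 (⊆-keep g1) (⊆-under₂ g2) d1 d2)
cut ih D1@(∨R m p) D2 g1 g2 d1 d2 = cutLeft∨R ih D1 p D2 g1 g2 d1 d2 (d1 m)
cut ih (⊃L m p q) D2 g1 g2 d1 d2 =
  ⊃L (g1 m) (cut ih p D2 g1 g2 (⊆-under d1) (there ∘ d2)) (cut ih q D2 (⊆-keep g1) (⊆-under₂ g2) d1 d2)
cut ih D1@(⊃R m p) D2 g1 g2 d1 d2 = cutLeft⊃R ih D1 p D2 g1 g2 d1 d2 (d1 m)
cut ih (mod r) D2 g1 g2 d1 d2 = cutLeftModal ih r D2 g1 g2 d1 d2

cutPrincipal∧ : ∀ {L B C B' C' Γ1 Δ1 Γ2 Δ2 Γ Δ} → CutBelow L (B ∧̇ C) →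
  L ⊩ Γ1 ⇒ Δ1 → L ⊩ Γ1 ⇒ B ∷ Δ1 → L ⊩ Γ1 ⇒ C ∷ Δ1 → L ⊩ Γ2 ⇒ Δ2 → L ⊩ B' ∷ C' ∷ Γ2 ⇒ Δ2 →
  Γ1 ⊆ Γ → Γ2 ⊆ (B ∧̇ C) ∷ Γ → Δ1 ⊆ (B ∧̇ C) ∷ Δ → Δ2 ⊆ Δ → (B' ∧̇ C') ∈ (B ∧̇ C) ∷ Γ → L ⊩ Γ ⇒ Δ
cutPrincipal∧ ih D1 p q D2 r g1 g2 d1 d2 (there m) =
  ∧L m (cutRight∧ ih D1 p q r (there ∘ there ∘ g1) (⊆-under (⊆-under g2)) d1 d2)
cutPrincipal∧ ih D1 p q D2 r g1 g2 d1 d2 (here refl) =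
  cutWith (proj₁ ih) ⇒B (proj₂ ih ⇒C B,C⇒ there ⊆-swap ⊆-refl ⊆-refl)
  where
  ⇒B = cut ih p D2 g1 g2 (⊆-under d1) (there ∘ d2)
  ⇒C = cut ih q D2 g1 g2 (⊆-under d1) (there ∘ d2)
  B,C⇒ = cut ih D1 r (there ∘ there ∘ g1) (⊆-under (⊆-under g2)) d1 d2

cutPrincipal∨ : ∀ {L B C B' C' Γ1 Δ1 Γ2 Δ2 Γ Δ} → CutBelow L (B ∨̇ C) →
  L ⊩ Γ1 ⇒ Δ1 → L ⊩ Γ1 ⇒ B ∷ C ∷ Δ1 → L ⊩ Γ2 ⇒ Δ2 → L ⊩ B' ∷ Γ2 ⇒ Δ2 → L ⊩ C' ∷ Γ2 ⇒ Δ2 →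
  Γ1 ⊆ Γ → Γ2 ⊆ (B ∨̇ C) ∷ Γ → Δ1 ⊆ (B ∨̇ C) ∷ Δ → Δ2 ⊆ Δ → (B' ∨̇ C') ∈ (B ∨̇ C) ∷ Γ → L ⊩ Γ ⇒ Δ
cutPrincipal∨ ih D1 p D2 r s g1 g2 d1 d2 (there m) =
  ∨L m (cutRight∨ ih D1 p r (there ∘ g1) (⊆-under g2) d1 d2) (cutRight∨ ih D1 p s (there ∘ g1) (⊆-under g2) d1 d2)
cutPrincipal∨ ih D1 p D2 r s g1 g2 d1 d2 (here refl) =
  cutWith (proj₁ ih) (proj₂ ih ⇒B,C C⇒ ⊆-refl ⊆-refl ⊆-swap there) B⇒
  where
  ⇒B,C = cut ih p D2 g1 g2 (⊆-under (⊆-under d1)) (there ∘ there ∘ d2)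
  B⇒ = cut ih D1 r (there ∘ g1) (⊆-under g2) d1 d2
  C⇒ = cut ih D1 s (there ∘ g1) (⊆-under g2) d1 d2

cutPrincipal⊃ : ∀ {L B C B' C' Γ1 Δ1 Γ2 Δ2 Γ Δ} → CutBelow L (B ⊃ C) →
  L ⊩ Γ1 ⇒ Δ1 → L ⊩ B ∷ Γ1 ⇒ C ∷ Δ1 → L ⊩ Γ2 ⇒ Δ2 → L ⊩ Γ2 ⇒ B' ∷ Δ2 → L ⊩ C' ∷ Γ2 ⇒ Δ2 →
  Γ1 ⊆ Γ → Γ2 ⊆ (B ⊃ C) ∷ Γ → Δ1 ⊆ (B ⊃ C) ∷ Δ → Δ2 ⊆ Δ → (B' ⊃ C') ∈ (B ⊃ C) ∷ Γ → L ⊩ Γ ⇒ Δ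
cutPrincipal⊃ ih D1 p D2 r s g1 g2 d1 d2 (there m) =
  ⊃L m (cutRight⊃ ih D1 p r g1 g2 (⊆-under₂ d1) (⊆-keep d2)) (cutRight⊃ ih D1 p s (there ∘ g1) (⊆-under g2) d1 d2)
cutPrincipal⊃ ih D1 p D2 r s g1 g2 d1 d2 (here refl) =
  cutWith (proj₁ ih) ⇒B (proj₂ ih B⇒C C⇒ ⊆-refl (⊆-keep there) ⊆-refl ⊆-refl)
  where
  ⇒B = cut ih D1 r g1 g2 (⊆-under₂ d1) (⊆-keep d2)
  B⇒C = cut ih p D2 (⊆-keep g1) (⊆-under₂ g2) (⊆-under d1) (there ∘ d2)
  C⇒ = cut ih D1 s (there ∘ g1) (⊆-under g2) d1 d2

cutRight∧ ih D1 p q (ax m1 m2) g1 g2 d1 d2 with g2 m1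
... | there m = ax m (d2 m2)
cutRight∧ ih D1 p q (ax⊥ m) g1 g2 d1 d2 with g2 m
... | there m' = ax⊥ m'
cutRight∧ ih D1 p q (∨R m r) g1 g2 d1 d2 =
  ∨R (d2 m) (cutRight∧ ih D1 p q r g1 g2 (⊆-under₂ (⊆-under₂ d1)) (⊆-keep (⊆-keep d2)))
cutRight∧ ih D1 p q (∧R m r s) g1 g2 d1 d2 =
  ∧R (d2 m) (cutRight∧ ih D1 p q r g1 g2 (⊆-under₂ d1) (⊆-keep d2))
    (cutRight∧ ih D1 p q s g1 g2 (⊆-under₂ d1) (⊆-keep d2))
cutRight∧ ih D1 p q (⊃R m r) g1 g2 d1 d2 =
  ⊃R (d2 m) (cutRight∧ ih D1 p q r (there ∘ g1) (⊆-under g2) (⊆-under₂ d1) (⊆-keep d2))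
cutRight∧ ih D1 p q (mod r) g1 g2 d1 d2 = mod (wkModal r (λ x → dropNonBox (λ ()) (g2 x)) d2)
cutRight∧ ih D1 p q D2@(∧L m r) g1 g2 d1 d2 = cutPrincipal∧ ih D1 p q D2 r g1 g2 d1 d2 (g2 m)
cutRight∧ ih D1 p q (∨L m r s) g1 g2 d1 d2 with g2 m
... | there m' =
    ∨L m' (cutRight∧ ih D1 p q r (there ∘ g1) (⊆-under g2) d1 d2)
      (cutRight∧ ih D1 p q s (there ∘ g1) (⊆-under g2) d1 d2)
cutRight∧ ih D1 p q (⊃L m r s) g1 g2 d1 d2 with g2 m
... | there m' =
    ⊃L m' (cutRight∧ ih D1 p q r g1 g2 (⊆-under₂ d1) (⊆-keep d2))
      (cutRight∧ ih D1 p q s (there ∘ g1) (⊆-under g2) d1 d2)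

cutRight∨ ih D1 p (ax m1 m2) g1 g2 d1 d2 with g2 m1
... | there m = ax m (d2 m2)
cutRight∨ ih D1 p (ax⊥ m) g1 g2 d1 d2 with g2 m
... | there m' = ax⊥ m'
cutRight∨ ih D1 p (∨R m r) g1 g2 d1 d2 =
  ∨R (d2 m) (cutRight∨ ih D1 p r g1 g2 (⊆-under₂ (⊆-under₂ d1)) (⊆-keep (⊆-keep d2)))
cutRight∨ ih D1 p (∧R m r s) g1 g2 d1 d2 =
  ∧R (d2 m) (cutRight∨ ih D1 p r g1 g2 (⊆-under₂ d1) (⊆-keep d2))
    (cutRight∨ ih D1 p s g1 g2 (⊆-under₂ d1) (⊆-keep d2))
cutRight∨ ih D1 p (⊃R m r) g1 g2 d1 d2 =
  ⊃R (d2 m) (cutRight∨ ih D1 p r (there ∘ g1) (⊆-under g2) (⊆-under₂ d1) (⊆-keep d2))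
cutRight∨ ih D1 p (mod r) g1 g2 d1 d2 = mod (wkModal r (λ x → dropNonBox (λ ()) (g2 x)) d2)
cutRight∨ ih D1 p (∧L m r) g1 g2 d1 d2 with g2 m
... | there m' = ∧L m' (cutRight∨ ih D1 p r (there ∘ there ∘ g1) (⊆-under (⊆-under g2)) d1 d2)
cutRight∨ ih D1 p D2@(∨L m r s) g1 g2 d1 d2 = cutPrincipal∨ ih D1 p D2 r s g1 g2 d1 d2 (g2 m)
cutRight∨ ih D1 p (⊃L m r s) g1 g2 d1 d2 with g2 m
... | there m' =
    ⊃L m' (cutRight∨ ih D1 p r g1 g2 (⊆-under₂ d1) (⊆-keep d2))
      (cutRight∨ ih D1 p s (there ∘ g1) (⊆-under g2) d1 d2)

cutRight⊃ ih D1 p (ax m1 m2) g1 g2 d1 d2 with g2 m1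
... | there m = ax m (d2 m2)
cutRight⊃ ih D1 p (ax⊥ m) g1 g2 d1 d2 with g2 m
... | there m' = ax⊥ m'
cutRight⊃ ih D1 p (∨R m r) g1 g2 d1 d2 =
  ∨R (d2 m) (cutRight⊃ ih D1 p r g1 g2 (⊆-under₂ (⊆-under₂ d1)) (⊆-keep (⊆-keep d2)))
cutRight⊃ ih D1 p (∧R m r s) g1 g2 d1 d2 =
  ∧R (d2 m) (cutRight⊃ ih D1 p r g1 g2 (⊆-under₂ d1) (⊆-keep d2))
    (cutRight⊃ ih D1 p s g1 g2 (⊆-under₂ d1) (⊆-keep d2))
cutRight⊃ ih D1 p (⊃R m r) g1 g2 d1 d2 =
  ⊃R (d2 m) (cutRight⊃ ih D1 p r (there ∘ g1) (⊆-under g2) (⊆-under₂ d1) (⊆-keep d2))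
cutRight⊃ ih D1 p (mod r) g1 g2 d1 d2 = mod (wkModal r (λ x → dropNonBox (λ ()) (g2 x)) d2)
cutRight⊃ ih D1 p (∧L m r) g1 g2 d1 d2 with g2 m
... | there m' = ∧L m' (cutRight⊃ ih D1 p r (there ∘ there ∘ g1) (⊆-under (⊆-under g2)) d1 d2)
cutRight⊃ ih D1 p (∨L m r s) g1 g2 d1 d2 with g2 m
... | there m' =
    ∨L m' (cutRight⊃ ih D1 p r (there ∘ g1) (⊆-under g2) d1 d2)
      (cutRight⊃ ih D1 p s (there ∘ g1) (⊆-under g2) d1 d2)
cutRight⊃ ih D1 p D2@(⊃L m r s) g1 g2 d1 d2 = cutPrincipal⊃ ih D1 p D2 r s g1 g2 d1 d2 (g2 m)

cutAdmissible : ∀ {L} A → CutAdmissible L A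
cutBelow : ∀ {L} A → CutBelow L A
cutAdmissible A = cut (cutBelow A)
cutBelow (var n) = tt
cutBelow ⊥̇ = tt
cutBelow (A ∧̇ B) = cutAdmissible A , cutAdmissible B
cutBelow (A ∨̇ B) = cutAdmissible A , cutAdmissible B
cutBelow (A ⊃ B) = cutAdmissible A , cutAdmissible B
cutBelow (□ A) = cutAdmissible A

cutRule : ∀ {L Γ Δ} A → L ⊩ Γ ⇒ A ∷ Δ → L ⊩ A ∷ Γ ⇒ Δ → L ⊩ Γ ⇒ Δ
cutRule A d1 d2 = cutAdmissible A d1 d2 ⊆-refl ⊆-refl ⊆-refl ⊆-refl

update : (ℕ → Bool) → ℕ → Bool → ℕ → Bool
update v k b i with i ≟ k
... | yes _ = b
... | no _ = v i

update-at : ∀ v k b → update v k b k ≡ b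
update-at v k b with k ≟ k
... | yes _ = refl
... | no k≢k = ⊥-elim (k≢k refl)

update-below : ∀ k v b i → i < k → update v k b i ≡ v i
update-below k v b i i<k with i ≟ k
... | yes refl = ⊥-elim (<-irrefl refl i<k)
... | no _ = refl

update-same : ∀ v k b → v k ≡ b → ∀ i → update v k b i ≡ v i
update-same v k b e i with i ≟ k
... | yes refl = sym e
... | no _ = refl

VarsBelow : ℕ → PFm → Set
VarsBelow k (pvar n) = n < k
VarsBelow k p⊥ = ⊤
VarsBelow k (a p∧ b) = VarsBelow k a × VarsBelow k b
VarsBelow k (a p∨ b) = VarsBelow k a × VarsBelow k b
VarsBelow k (a p⊃ b) = VarsBelow k a × VarsBelow k b

varsBelow-mono : ∀ {k k'} φ → k ≤ k' → VarsBelow k φ → VarsBelow k' φ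
varsBelow-mono (pvar n) le b = <-≤-trans b le
varsBelow-mono p⊥ le b = tt
varsBelow-mono (a p∧ c) le (x , y) = varsBelow-mono a le x , varsBelow-mono c le y
varsBelow-mono (a p∨ c) le (x , y) = varsBelow-mono a le x , varsBelow-mono c le y
varsBelow-mono (a p⊃ c) le (x , y) = varsBelow-mono a le x , varsBelow-mono c le y

varBound : PFm → ℕ
varBound (pvar n) = suc n
varBound p⊥ = zero
varBound (a p∧ b) = varBound a + varBound b
varBound (a p∨ b) = varBound a + varBound b
varBound (a p⊃ b) = varBound a + varBound b

varsBelow-varBound : ∀ φ → VarsBelow (varBound φ) φ
varsBelow-varBound (pvar n) = ≤-refl
varsBelow-varBound p⊥ = tt
varsBelow-varBound (a p∧ b) =
  varsBelow-mono a (m≤m+n _ _) (varsBelow-varBound a) , varsBelow-mono b (m≤n+m _ _) (varsBelow-varBound b)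
varsBelow-varBound (a p∨ b) =
  varsBelow-mono a (m≤m+n _ _) (varsBelow-varBound a) , varsBelow-mono b (m≤n+m _ _) (varsBelow-varBound b)
varsBelow-varBound (a p⊃ b) =
  varsBelow-mono a (m≤m+n _ _) (varsBelow-varBound a) , varsBelow-mono b (m≤n+m _ _) (varsBelow-varBound b)

consIf : Bool → Fm → List Fm → List Fm
consIf true x xs = x ∷ xs
consIf false x xs = xs

consIf-⊇ : ∀ {x y : Fm} {xs} b → x ∈ xs → x ∈ consIf b y xs
consIf-⊇ true m = there m
consIf-⊇ false m = m

-- Kalmár's lemma in the sequent calculus, for substitution instances under σ: with the images
-- of the variables below k that are true under v on the left and the false ones on the right,
-- the instance of φ is derivable on the side given by its truth value under v.
module Kalmár (L : Logic) (σ : ℕ → Fm) where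
  trueAtoms falseAtoms : (ℕ → Bool) → ℕ → List Fm
  trueAtoms v zero = []
  trueAtoms v (suc k) = consIf (v k) (σ k) (trueAtoms v k)
  falseAtoms v zero = []
  falseAtoms v (suc k) = consIf (not (v k)) (σ k) (falseAtoms v k)

  ∈-trueAtoms : ∀ v n k → n < k → v n ≡ true → σ n ∈ trueAtoms v k
  ∈-trueAtoms v n (suc k) lt e with n ≟ k
  ... | yes refl rewrite e = here refl
  ... | no n≢k = consIf-⊇ (v k) (∈-trueAtoms v n k (≤∧≢⇒< (≤-pred lt) n≢k) e)

  ∈-falseAtoms : ∀ v n k → n < k → v n ≡ false → σ n ∈ falseAtoms v k
  ∈-falseAtoms v n (suc k) lt e with n ≟ k
  ... | yes refl rewrite e = here refl
  ... | no n≢k = consIf-⊇ (not (v k)) (∈-falseAtoms v n k (≤∧≢⇒< (≤-pred lt) n≢k) e)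

  Decided : ℕ → (ℕ → Bool) → PFm → Set
  Decided k v φ = (eval v φ ≡ true → L ⊩ trueAtoms v k ⇒ subst σ φ ∷ falseAtoms v k)
                × (eval v φ ≡ false → L ⊩ subst σ φ ∷ trueAtoms v k ⇒ falseAtoms v k)

  kalmar : ∀ k φ → VarsBelow k φ → ∀ v → Decided k v φ
  kalmar k (pvar n) bn v = (λ e → identity (σ n) (∈-trueAtoms v n k bn e) (here refl))
                         , (λ e → identity (σ n) (here refl) (∈-falseAtoms v n k bn e))
  kalmar k p⊥ _ v = (λ ()) , (λ _ → ax⊥ (here refl))
  kalmar k (a p∧ b) (ba , bb) v with eval v a | eval v b | kalmar k a ba v | kalmar k b bb v
  ... | true | true | (a⁺ , _) | (b⁺ , _) =
    (λ _ → ∧R (here refl) (wk (a⁺ refl) ⊆-refl (⊆-keep there)) (wk (b⁺ refl) ⊆-refl (⊆-keep there))) , (λ ())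
  ... | false | _ | (_ , a⁻) | _ = (λ ()) , (λ _ → ∧L (here refl) (wk (a⁻ refl) ⊆-pick₁ ⊆-refl))
  ... | true | false | _ | (_ , b⁻) = (λ ()) , (λ _ → ∧L (here refl) (wk (b⁻ refl) ⊆-pick₂ ⊆-refl))
  kalmar k (a p∨ b) (ba , bb) v with eval v a | eval v b | kalmar k a ba v | kalmar k b bb v
  ... | true | _ | (a⁺ , _) | _ = (λ _ → ∨R (here refl) (wk (a⁺ refl) ⊆-refl ⊆-pick₁)) , (λ ())
  ... | false | true | _ | (b⁺ , _) = (λ _ → ∨R (here refl) (wk (b⁺ refl) ⊆-refl ⊆-pick₂)) , (λ ())
  ... | false | false | (_ , a⁻) | (_ , b⁻) =
    (λ ()) , (λ _ → ∨L (here refl) (wk (a⁻ refl) (⊆-keep there) ⊆-refl) (wk (b⁻ refl) (⊆-keep there) ⊆-refl))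
  kalmar k (a p⊃ b) (ba , bb) v with eval v a | eval v b | kalmar k a ba v | kalmar k b bb v
  ... | false | _ | (_ , a⁻) | _ = (λ _ → ⊃R (here refl) (wk (a⁻ refl) ⊆-refl (there ∘ there))) , (λ ())
  ... | true | true | _ | (b⁺ , _) = (λ _ → ⊃R (here refl) (wk (b⁺ refl) there (⊆-keep there))) , (λ ())
  ... | true | false | (a⁺ , _) | (_ , b⁻) =
    (λ ()) , (λ _ → ⊃L (here refl) (wk (a⁺ refl) there ⊆-refl) (wk (b⁻ refl) (⊆-keep there) ⊆-refl))

  trueAtoms-agree : ∀ k v w → (∀ i → i < k → v i ≡ w i) → trueAtoms v k ≡ trueAtoms w k
  trueAtoms-agree zero v w h = refl
  trueAtoms-agree (suc k) v w h =
    cong₂ (λ x ys → consIf x (σ k) ys) (h k ≤-refl) (trueAtoms-agree k v w (λ i lt → h i (m<n⇒m<1+n lt)))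
  falseAtoms-agree : ∀ k v w → (∀ i → i < k → v i ≡ w i) → falseAtoms v k ≡ falseAtoms w k
  falseAtoms-agree zero v w h = refl
  falseAtoms-agree (suc k) v w h =
    cong₂ (λ x ys → consIf (not x) (σ k) ys) (h k ≤-refl)
      (falseAtoms-agree k v w (λ i lt → h i (m<n⇒m<1+n lt)))

  -- Removing the atoms one at a time: the sequents for v[k≔true] and v[k≔false] differ only in
  -- σ k, which is cut away.
  module _ (F : Fm) where
    Derivable : ℕ → Set
    Derivable k = ∀ v → L ⊩ trueAtoms v k ⇒ F ∷ falseAtoms v k

    eliminateVar : ∀ k → Derivable (suc k) → Derivable k
    eliminateVar k e v = cutRule (σ k) D0 D1
      where
      p1 : trueAtoms (update v k true) (suc k) ≡ σ k ∷ trueAtoms v k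
      p1 rewrite update-at v k true = cong (σ k ∷_) (trueAtoms-agree k _ v (update-below k v true))
      n1 : falseAtoms (update v k true) (suc k) ≡ falseAtoms v k
      n1 rewrite update-at v k true = falseAtoms-agree k _ v (update-below k v true)
      p0 : trueAtoms (update v k false) (suc k) ≡ trueAtoms v k
      p0 rewrite update-at v k false = trueAtoms-agree k _ v (update-below k v false)
      n0 : falseAtoms (update v k false) (suc k) ≡ σ k ∷ falseAtoms v k
      n0 rewrite update-at v k false = cong (σ k ∷_) (falseAtoms-agree k _ v (update-below k v false))
      D1 : L ⊩ σ k ∷ trueAtoms v k ⇒ F ∷ falseAtoms v k
      D1 = subst₂ (λ G D → L ⊩ G ⇒ F ∷ D) p1 n1 (e (update v k true))
      D0' : L ⊩ trueAtoms v k ⇒ F ∷ σ k ∷ falseAtoms v k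
      D0' = subst₂ (λ G D → L ⊩ G ⇒ F ∷ D) p0 n0 (e (update v k false))
      D0 : L ⊩ trueAtoms v k ⇒ σ k ∷ F ∷ falseAtoms v k
      D0 = wk D0' ⊆-refl ⊆-swap

    eliminateAll : ∀ k → Derivable k → Derivable 0
    eliminateAll zero e = e
    eliminateAll (suc k) e = eliminateAll k (eliminateVar k e)

  tautology : (φ : PFm) → Tautology φ → L ⊩ [] ⇒ subst σ φ ∷ []
  tautology φ t =
    eliminateAll (subst σ φ) (varBound φ) (λ v → proj₁ (kalmar (varBound φ) φ (varsBelow-varBound φ) v) (t v))
      (λ _ → false)


axiomDerivable : ∀ {L S F} → S ∈ schemes L → Instance S F → L ⊩ [] ⇒ F ∷ []
axiomDerivable {L} {M} m (A , B , refl) =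
  ⊃R (here refl) (∧R (here refl)
    (monoRule (has-complete m) (here refl) (here refl) (∧L (here refl) (identity A (here refl) (here refl))))
    (monoRule (has-complete m) (here refl) (here refl) (∧L (here refl) (identity B (there (here refl)) (here refl)))))
axiomDerivable {L} {C} m (A , B , refl) =
  ⊃R (here refl) (∧L (here refl) (mod (rC (A ∷ B ∷ []) (has-complete m) (inj₂ nonEmpty)
    (here refl ∷ there (here refl) ∷ []) (here refl)
    (∧R (here refl) (identity A (here refl) (here refl)) (identity B (there (here refl)) (here refl))))))
axiomDerivable {L} {N} m refl with has C L in c
... | true = mod (rC [] c (inj₁ (has-complete m)) [] (here refl) (⊃R (here refl) (ax⊥ (here refl))))
... | false = mod (rN (has-complete m) c (here refl) (⊃R (here refl) (ax⊥ (here refl))))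
axiomDerivable {L} {D⊥} m refl with has C L in c
... | true =
    ⊃R (here refl) (mod (rCD (⊥̇ ∷ []) c (has-complete m) nonEmpty (here refl ∷ []) (ax⊥ (here refl))))
... | false = ⊃R (here refl) (mod (rD (has-complete m) c (here refl) (ax⊥ (here refl))))
axiomDerivable {L} {D◇} m (A , refl) = ⊃R (here refl) (⊃R (here refl) boxes⇒)
  where
  d = has-complete m
  exclusive : L ⊩ A ∷ (¬̇ A) ∷ [] ⇒ []
  exclusive = ⊃L (there (here refl)) (identity A (here refl) (here refl)) (ax⊥ (here refl))
  exhaustive : L ⊩ [] ⇒ A ∷ (¬̇ A) ∷ []
  exhaustive = ⊃R (there (here refl)) (identity A (here refl) (there (here refl)))
  boxes⇒ : L ⊩ □ (¬̇ A) ∷ □ A ∷ [] ⇒ ⊥̇ ∷ ◇ A ∷ (□ A ⊃ ◇ A) ∷ []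
  boxes⇒ with has M L in e | has C L in c
  ... | false | _ = mod (rDE d e (there (here refl)) (here refl) exhaustive exclusive)
  ... | true | false = mod (rDM d e c (there (here refl)) (here refl) exclusive)
  ... | true | true = mod (rCD (A ∷ ¬̇ A ∷ []) c (D◇⇒D⊥ L d (inj₂ c)) nonEmpty
                           (there (here refl) ∷ here refl ∷ []) exclusive)

implicationSequent : ∀ {L A B} → L ⊩ [] ⇒ (A ⊃ B) ∷ [] → L ⊩ A ∷ [] ⇒ B ∷ []
implicationSequent {A = A} {B} d =
  cutRule (A ⊃ B) (wk d ⊆-[] ⊆-head)
    (⊃L (here refl) (identity A (there (here refl)) (here refl)) (identity B (here refl) (here refl)))

conjunct₁ : ∀ {L A B} → L ⊩ [] ⇒ (A ∧̇ B) ∷ [] → L ⊩ [] ⇒ A ∷ []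
conjunct₁ {A = A} {B} d =
  cutRule (A ∧̇ B) (wk d ⊆-refl ⊆-head) (∧L (here refl) (identity A (here refl) (here refl)))

conjunct₂ : ∀ {L A B} → L ⊩ [] ⇒ (A ∧̇ B) ∷ [] → L ⊩ [] ⇒ B ∷ []
conjunct₂ {A = A} {B} d =
  cutRule (A ∧̇ B) (wk d ⊆-refl ⊆-head) (∧L (here refl) (identity B (there (here refl)) (here refl)))

completeness : ∀ {L F} → L ⊢ F → L ⊩ [] ⇒ F ∷ []
completeness {L} (taut (φ , σ , t , refl)) = Kalmár.tautology L σ φ t
completeness (ax m i) = axiomDerivable m i
completeness (mp {A} d1 d2) =
  cutRule A (wk (completeness d2) ⊆-refl ⊆-head) (implicationSequent (completeness d1))
completeness (re d) =
  ∧R (here refl) (⊃R (here refl) (eqRule (here refl) (here refl) a⇒b b⇒a))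
                 (⊃R (here refl) (eqRule (here refl) (here refl) b⇒a a⇒b))
  where
  a⇒b = implicationSequent (conjunct₁ (completeness d))
  b⇒a = implicationSequent (conjunct₂ (completeness d))

allRows : ℕ → (ℕ → Bool) → PFm → Bool
allRows zero v φ = eval v φ
allRows (suc k) v φ = allRows k (update v k true) φ ∧ allRows k (update v k false) φ

eval-ext : ∀ {v w} φ → (∀ i → v i ≡ w i) → eval v φ ≡ eval w φ
eval-ext (pvar n) h = h n
eval-ext p⊥ h = refl
eval-ext (a p∧ b) h = cong₂ _∧_ (eval-ext a h) (eval-ext b h)
eval-ext (a p∨ b) h = cong₂ _∨_ (eval-ext a h) (eval-ext b h)
eval-ext (a p⊃ b) h = cong₂ (λ x y → not x ∨ y) (eval-ext a h) (eval-ext b h)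

allRows-sound : ∀ k v φ → allRows k v φ ≡ true → eval v φ ≡ true
allRows-sound zero v φ h = h
allRows-sound (suc k) v φ h with v k in e
... | true = trans (sym (eval-ext φ (update-same v k true e))) (allRows-sound k _ φ (∧-conicalˡ _ _ h))
... | false = trans (sym (eval-ext φ (update-same v k false e))) (allRows-sound k _ φ (∧-conicalʳ _ _ h))

listSubst : List Fm → ℕ → Fm
listSubst [] _ = ⊥̇
listSubst (x ∷ xs) zero = x
listSubst (x ∷ xs) (suc n) = listSubst xs n

-- An instance of a propositional formula passing the truth table on its variables is a
-- theorem; for concrete formulas the check is closed by  λ _ → refl.
byTruthTable : ∀ {Ss} φ (xs : List Fm) → (∀ v → allRows (length xs) v φ ≡ true) →
  Thm Ss (subst (listSubst xs) φ)
byTruthTable φ xs check = taut (φ , listSubst xs , (λ v → allRows-sound (length xs) v φ (check v)) , refl)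

p₀ p₁ p₂ p₃ p₄ ⊤ₚ : PFm
p₀ = pvar 0
p₁ = pvar 1
p₂ = pvar 2
p₃ = pvar 3
p₄ = pvar 4
⊤ₚ = p⊥ p⊃ p⊥

module Propositional {Ss : List Scheme} where
  ⊃-trans : ∀ {P Q R} → Thm Ss (P ⊃ Q) → Thm Ss (Q ⊃ R) → Thm Ss (P ⊃ R)
  ⊃-trans {P} {Q} {R} h1 h2 =
    mp (mp (byTruthTable ((p₀ p⊃ p₁) p⊃ ((p₁ p⊃ p₂) p⊃ (p₀ p⊃ p₂))) (P ∷ Q ∷ R ∷ []) (λ _ → refl)) h1) h2

  ⊃-pair : ∀ {P Q R} → Thm Ss (P ⊃ Q) → Thm Ss (P ⊃ R) → Thm Ss (P ⊃ (Q ∧̇ R))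
  ⊃-pair {P} {Q} {R} h1 h2 =
    mp (mp (byTruthTable ((p₀ p⊃ p₁) p⊃ ((p₀ p⊃ p₂) p⊃ (p₀ p⊃ (p₁ p∧ p₂)))) (P ∷ Q ∷ R ∷ []) (λ _ → refl)) h1) h2

  fst : ∀ {P Q} → Thm Ss ((P ∧̇ Q) ⊃ P)
  fst {P} {Q} = byTruthTable ((p₀ p∧ p₁) p⊃ p₀) (P ∷ Q ∷ []) (λ _ → refl)

  snd : ∀ {P Q} → Thm Ss ((P ∧̇ Q) ⊃ Q)
  snd {P} {Q} = byTruthTable ((p₀ p∧ p₁) p⊃ p₁) (P ∷ Q ∷ []) (λ _ → refl)

  inl : ∀ {P Q} → Thm Ss (P ⊃ (P ∨̇ Q))
  inl {P} {Q} = byTruthTable (p₀ p⊃ (p₀ p∨ p₁)) (P ∷ Q ∷ []) (λ _ → refl)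

  inr : ∀ {P Q} → Thm Ss (Q ⊃ (P ∨̇ Q))
  inr {P} {Q} = byTruthTable (p₁ p⊃ (p₀ p∨ p₁)) (P ∷ Q ∷ []) (λ _ → refl)

  ⊃-refl : ∀ {P} → Thm Ss (P ⊃ P)
  ⊃-refl {P} = byTruthTable (p₀ p⊃ p₀) (P ∷ []) (λ _ → refl)

  exFalso : ∀ {P} → Thm Ss (⊥̇ ⊃ P)
  exFalso {P} = byTruthTable (p⊥ p⊃ p₀) (P ∷ []) (λ _ → refl)

  const : ∀ {P Q} → Thm Ss Q → Thm Ss (P ⊃ Q)
  const {P} {Q} h = mp (byTruthTable (p₀ p⊃ (p₁ p⊃ p₀)) (Q ∷ P ∷ []) (λ _ → refl)) h

  boxCongruence : ∀ {A B} → Thm Ss (A ⊃ B) → Thm Ss (B ⊃ A) → Thm Ss (□ A ⊃ □ B)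
  boxCongruence {A} {B} h1 h2 =
    mp fst (re (mp (mp (byTruthTable ((p₀ p⊃ p₁) p⊃ ((p₁ p⊃ p₀) p⊃ ((p₀ p⊃ p₁) p∧ (p₁ p⊃ p₀))))
                                      (A ∷ B ∷ []) (λ _ → refl)) h1) h2))

  -- With M, the rule  A ⊃ B / □A ⊃ □B  is derivable (via RE on A ↔ A ∧ B).
  monotonicity : ∀ {A B} → M ∈ Ss → Thm Ss (A ⊃ B) → Thm Ss (□ A ⊃ □ B)
  monotonicity {A} {B} hasM h =
    ⊃-trans (boxCongruence (⊃-pair ⊃-refl h) fst) (⊃-trans (ax hasM (A , B , refl)) snd)

open Propositional

conj disj : List Fm → Fm
conj [] = ⊤̇
conj (A ∷ Γ) = A ∧̇ conj Γ
disj [] = ⊥̇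
disj (A ∷ Δ) = A ∨̇ disj Δ

⟦_⇒_⟧ : List Fm → List Fm → Fm
⟦ Γ ⇒ Δ ⟧ = conj Γ ⊃ disj Δ

conj-elim : ∀ {Ss F Γ} → F ∈ Γ → Thm Ss (conj Γ ⊃ F)
conj-elim (here refl) = fst
conj-elim (there m) = ⊃-trans snd (conj-elim m)

disj-intro : ∀ {Ss F Δ} → F ∈ Δ → Thm Ss (F ⊃ disj Δ)
disj-intro (here refl) = inl
disj-intro (there m) = ⊃-trans (disj-intro m) inr

singleSequent : ∀ {Ss A B} → Thm Ss ⟦ A ∷ [] ⇒ B ∷ [] ⟧ → Thm Ss (A ⊃ B)
singleSequent {A = A} {B} h =
  mp (byTruthTable (((p₀ p∧ ⊤ₚ) p⊃ (p₁ p∨ p⊥)) p⊃ (p₀ p⊃ p₁)) (A ∷ B ∷ []) (λ _ → refl)) h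

boxConj : ∀ {L Γ As} → has C L ≡ true → (has N L ≡ true ⊎ NonEmpty As) → Boxed Γ As →
  L ⊢ (conj Γ ⊃ □ (conj As))
boxConj c (inj₁ n) [] = const (ax (has-sound n) refl)
boxConj c (inj₂ ()) []
boxConj c ok (_∷_ {a} m []) =
  ⊃-trans (conj-elim m) (boxCongruence (⊃-pair ⊃-refl (const (⊃-refl {P = ⊥̇}))) fst)
boxConj c ok (_∷_ {a} m (_∷_ {b} {bs} m' al)) =
  ⊃-trans (⊃-pair (conj-elim m) (boxConj c (inj₂ nonEmpty) (m' ∷ al))) (ax (has-sound c) (a , conj (b ∷ bs) , refl))

deontic◇ : ∀ {L Γ Δ A B} → has D◇ L ≡ true → □ A ∈ Γ → □ B ∈ Γ → L ⊢ (□ B ⊃ □ (¬̇ A)) → L ⊢ ⟦ Γ ⇒ Δ ⟧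
deontic◇ {Γ = Γ} {Δ} {A} {B} d m1 m2 h =
  mp (mp (mp (mp (byTruthTable ((p₀ p⊃ p₁) p⊃ ((p₀ p⊃ p₂) p⊃ ((p₂ p⊃ p₃) p⊃ ((p₁ p⊃ (p₃ p⊃ p⊥)) p⊃ (p₀ p⊃ p₄)))))
                               (conj Γ ∷ □ A ∷ □ B ∷ □ (¬̇ A) ∷ disj Δ ∷ []) (λ _ → refl))
                 (conj-elim m1)) (conj-elim m2)) h) (ax (has-sound d) (A , refl))

-- Soundness: a derivable sequent Γ ⇒ Δ yields the theorem ⋀Γ ⊃ ⋁Δ.  Each rule is justified
-- by one propositional tautology over the principal formulas, ⋀Γ and ⋁Δ.
soundness : ∀ {L Γ Δ} → L ⊩ Γ ⇒ Δ → L ⊢ ⟦ Γ ⇒ Δ ⟧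
soundnessModal : ∀ {L Γ Δ} → ModalRule L Γ Δ → L ⊢ ⟦ Γ ⇒ Δ ⟧

soundness (ax m1 m2) = ⊃-trans (conj-elim m1) (disj-intro m2)
soundness (ax⊥ m) = ⊃-trans (conj-elim m) exFalso
soundness (∧L m p) =
  ⊃-trans (⊃-pair (⊃-trans (conj-elim m) fst) (⊃-pair (⊃-trans (conj-elim m) snd) ⊃-refl)) (soundness p)
soundness (∧R {Γ} {Δ} {A} {B} m p q) =
  mp (mp (mp (byTruthTable ((p₂ p⊃ (p₀ p∨ p₃)) p⊃ ((p₂ p⊃ (p₁ p∨ p₃)) p⊃ (((p₀ p∧ p₁) p⊃ p₃) p⊃ (p₂ p⊃ p₃))))
                           (A ∷ B ∷ conj Γ ∷ disj Δ ∷ []) (λ _ → refl))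
             (soundness p)) (soundness q)) (disj-intro m)
soundness (∨L {Γ} {Δ} {A} {B} m p q) =
  mp (mp (mp (byTruthTable (((p₀ p∧ p₂) p⊃ p₃) p⊃ (((p₁ p∧ p₂) p⊃ p₃) p⊃ ((p₂ p⊃ (p₀ p∨ p₁)) p⊃ (p₂ p⊃ p₃))))
                           (A ∷ B ∷ conj Γ ∷ disj Δ ∷ []) (λ _ → refl))
             (soundness p)) (soundness q)) (conj-elim m)
soundness (∨R {Γ} {Δ} {A} {B} m p) =
  mp (mp (byTruthTable ((p₂ p⊃ (p₀ p∨ (p₁ p∨ p₃))) p⊃ (((p₀ p∨ p₁) p⊃ p₃) p⊃ (p₂ p⊃ p₃)))
                       (A ∷ B ∷ conj Γ ∷ disj Δ ∷ []) (λ _ → refl))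
         (soundness p)) (disj-intro m)
soundness (⊃L {Γ} {Δ} {A} {B} m p q) =
  mp (mp (mp (byTruthTable ((p₂ p⊃ (p₀ p∨ p₃)) p⊃ (((p₁ p∧ p₂) p⊃ p₃) p⊃ ((p₂ p⊃ (p₀ p⊃ p₁)) p⊃ (p₂ p⊃ p₃))))
                           (A ∷ B ∷ conj Γ ∷ disj Δ ∷ []) (λ _ → refl))
             (soundness p)) (soundness q)) (conj-elim m)
soundness (⊃R {Γ} {Δ} {A} {B} m p) =
  mp (mp (byTruthTable (((p₀ p∧ p₂) p⊃ (p₁ p∨ p₃)) p⊃ (((p₀ p⊃ p₁) p⊃ p₃) p⊃ (p₂ p⊃ p₃)))
                       (A ∷ B ∷ conj Γ ∷ disj Δ ∷ []) (λ _ → refl))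
         (soundness p)) (disj-intro m)
soundness (mod r) = soundnessModal r

soundnessModal (rE e m1 m2 p q) =
  ⊃-trans (conj-elim m1) (⊃-trans (boxCongruence (singleSequent (soundness p)) (singleSequent (soundness q))) (disj-intro m2))
soundnessModal (rM e c m1 m2 p) =
  ⊃-trans (conj-elim m1) (⊃-trans (monotonicity (has-sound e) (singleSequent (soundness p))) (disj-intro m2))
soundnessModal {L} (rC {B = B} As c ok al m2 p) =
  ⊃-trans (boxConj c ok al) (⊃-trans (monotonicity (has-sound (C⇒M L c)) premise) (disj-intro m2))
  where
  premise = mp (byTruthTable ((p₀ p⊃ (p₁ p∨ p⊥)) p⊃ (p₀ p⊃ p₁)) (conj As ∷ B ∷ []) (λ _ → refl)) (soundness p)
soundnessModal (rN {B = B} n c m2 p) = ⊃-trans (const □B) (disj-intro m2)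
  where
  hB = mp (byTruthTable ((⊤ₚ p⊃ (p₀ p∨ p⊥)) p⊃ p₀) (B ∷ []) (λ _ → refl)) (soundness p)
  □B = mp (boxCongruence (const hB) (const (⊃-refl {P = ⊥̇}))) (ax (has-sound n) refl)
soundnessModal (rD {Γ} {Δ} {A} d c m1 p) =
  mp (mp (byTruthTable ((p₀ p⊃ p₁) p⊃ ((p₁ p⊃ p⊥) p⊃ (p₀ p⊃ p₂))) (conj Γ ∷ □ A ∷ disj Δ ∷ []) (λ _ → refl)) (conj-elim m1))
     (⊃-trans (boxCongruence A⊃⊥ exFalso) (ax (has-sound d) refl))
  where
  A⊃⊥ = mp (byTruthTable (((p₀ p∧ ⊤ₚ) p⊃ p⊥) p⊃ (p₀ p⊃ p⊥)) (A ∷ []) (λ _ → refl)) (soundness p)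
soundnessModal (rDE {Γ} {Δ} {A} {B} d e m1 m2 p q) = deontic◇ d m1 m2 (boxCongruence B⊃¬A ¬A⊃B)
  where
  B⊃¬A =
    mp (byTruthTable (((p₀ p∧ (p₁ p∧ ⊤ₚ)) p⊃ p⊥) p⊃ (p₁ p⊃ (p₀ p⊃ p⊥))) (A ∷ B ∷ []) (λ _ → refl))
      (soundness q)
  ¬A⊃B =
    mp (byTruthTable ((⊤ₚ p⊃ (p₀ p∨ (p₁ p∨ p⊥))) p⊃ ((p₀ p⊃ p⊥) p⊃ p₁)) (A ∷ B ∷ []) (λ _ → refl))
      (soundness p)
soundnessModal (rDM {Γ} {Δ} {A} {B} d e c m1 m2 q) = deontic◇ d m1 m2 (monotonicity (has-sound e) B⊃¬A)
  where
  B⊃¬A =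
    mp (byTruthTable (((p₀ p∧ (p₁ p∧ ⊤ₚ)) p⊃ p⊥) p⊃ (p₁ p⊃ (p₀ p⊃ p⊥))) (A ∷ B ∷ []) (λ _ → refl))
      (soundness q)
soundnessModal {L} (rCD {Γ} {Δ} As c d n al p) =
  mp (mp (byTruthTable ((p₀ p⊃ p₁) p⊃ ((p₁ p⊃ p⊥) p⊃ (p₀ p⊃ p₂))) (conj Γ ∷ □ (conj As) ∷ disj Δ ∷ []) (λ _ → refl))
         (boxConj c (inj₂ n) al))
     (⊃-trans (monotonicity (has-sound (C⇒M L c)) (soundness p)) (ax (has-sound d) refl))

InVocab : ℕ → List Fm → List Fm → Set
InVocab n Γ Δ = Any (Occurs n) Γ ⊎ Any (Occurs n) Δ

headOrTailL : ∀ {n A Γ Δ} {X : Set} → (Occurs n A → X) → (InVocab n Γ Δ → X) → InVocab n (A ∷ Γ) Δ → X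
headOrTailL f g (inj₁ (here o)) = f o
headOrTailL f g (inj₁ (there a)) = g (inj₁ a)
headOrTailL f g (inj₂ a) = g (inj₂ a)

headOrTailR : ∀ {n A Γ Δ} {X : Set} → (Occurs n A → X) → (InVocab n Γ Δ → X) → InVocab n Γ (A ∷ Δ) → X
headOrTailR f g (inj₂ (here o)) = f o
headOrTailR f g (inj₂ (there a)) = g (inj₂ a)
headOrTailR f g (inj₁ a) = g (inj₁ a)

vocabL : ∀ {n x Γ Δ} → x ∈ Γ → Occurs n x → InVocab n Γ Δ
vocabL m o = inj₁ (lose m o)

vocabR : ∀ {n x Γ Δ} → x ∈ Δ → Occurs n x → InVocab n Γ Δ
vocabR m o = inj₂ (lose m o)

record Interpolant (L : Logic) (Γ1 Δ1 Γ2 Δ2 : List Fm) : Set where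
  constructor interpolant
  field
    I : Fm
    left : L ⊩ Γ1 ⇒ I ∷ Δ1
    right : L ⊩ I ∷ Γ2 ⇒ Δ2
    shared : ∀ n → Occurs n I → InVocab n Γ1 Δ1 × InVocab n Γ2 Δ2

Partition : List Fm → List Fm → List Fm → Set
Partition Γ Γ1 Γ2 = ∀ {x} → x ∈ Γ → x ∈ Γ1 ⊎ x ∈ Γ2

toFirst : ∀ {A Γ Γ1 Γ2} → Partition Γ Γ1 Γ2 → Partition (A ∷ Γ) (A ∷ Γ1) Γ2
toFirst s (here r) = inj₁ (here r)
toFirst s (there m) = Sum.map there id (s m)

toSecond : ∀ {A Γ Γ1 Γ2} → Partition Γ Γ1 Γ2 → Partition (A ∷ Γ) Γ1 (A ∷ Γ2)
toSecond s (here r) = inj₂ (here r)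
toSecond s (there m) = Sum.map id there (s m)

interpolant⊥ : ∀ {L Γ1 Δ1 Γ2 Δ2} → L ⊩ Γ1 ⇒ Δ1 → Interpolant L Γ1 Δ1 Γ2 Δ2
interpolant⊥ d = interpolant ⊥̇ (wk d ⊆-refl there) (ax⊥ (here refl)) (λ n ())

interpolant⊤ : ∀ {L Γ1 Δ1 Γ2 Δ2} → L ⊩ Γ2 ⇒ Δ2 → Interpolant L Γ1 Δ1 Γ2 Δ2
interpolant⊤ d =
  interpolant ⊤̇ (⊃R (here refl) (ax⊥ (here refl))) (wk d there ⊆-refl) (λ { n (⊃l ()) ; n (⊃r ()) })

⊆-pickSwap₁ : ∀ {i a j k : Fm} {Δ} → i ∷ a ∷ Δ ⊆ a ∷ i ∷ j ∷ k ∷ Δ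
⊆-pickSwap₁ (here r) = there (here r)
⊆-pickSwap₁ (there (here r)) = here r
⊆-pickSwap₁ (there (there x)) = there (there (there (there x)))

⊆-pickSwap₂ : ∀ {i a j k : Fm} {Δ} → i ∷ a ∷ Δ ⊆ a ∷ j ∷ i ∷ k ∷ Δ
⊆-pickSwap₂ (here r) = there (there (here r))
⊆-pickSwap₂ (there (here r)) = here r
⊆-pickSwap₂ (there (there x)) = there (there (there (there x)))

⊆-rotate : ∀ {i a b : Fm} {Δ} → i ∷ a ∷ b ∷ Δ ⊆ a ∷ b ∷ i ∷ Δ
⊆-rotate (here r) = there (there (here r))
⊆-rotate (there (here r)) = here r
⊆-rotate (there (there (here r))) = there (here r)
⊆-rotate (there (there (there x))) = there (there (there x))

-- The index ₁/₂ tells on which side the principal formula lies; a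
-- two-premise rule on side 1 combines the interpolants by ∨, on side 2 by ∧.
module _ {L : Logic} {Γ1 Δ1 Γ2 Δ2 : List Fm} where
  split∧L₁ : ∀ {A B} → (A ∧̇ B) ∈ Γ1 → Interpolant L (A ∷ B ∷ Γ1) Δ1 Γ2 Δ2 → Interpolant L Γ1 Δ1 Γ2 Δ2
  split∧L₁ a (interpolant I d1 d2 v) =
    interpolant I (∧L a d1) d2
      (λ n o → map₁ (headOrTailL (vocabL a ∘ ∧l) (headOrTailL (vocabL a ∘ ∧r) id)) (v n o))

  split∧L₂ : ∀ {A B} → (A ∧̇ B) ∈ Γ2 → Interpolant L Γ1 Δ1 (A ∷ B ∷ Γ2) Δ2 → Interpolant L Γ1 Δ1 Γ2 Δ2
  split∧L₂ a (interpolant I d1 d2 v) =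
    interpolant I d1 (∧L (there a) (wk d2 ⊆-rotate ⊆-refl))
      (λ n o → map₂ (headOrTailL (vocabL a ∘ ∧l) (headOrTailL (vocabL a ∘ ∧r) id)) (v n o))

  split∧R₁ : ∀ {A B} → (A ∧̇ B) ∈ Δ1 →
    Interpolant L Γ1 (A ∷ Δ1) Γ2 Δ2 → Interpolant L Γ1 (B ∷ Δ1) Γ2 Δ2 → Interpolant L Γ1 Δ1 Γ2 Δ2
  split∧R₁ b (interpolant I1 e1 f1 v1) (interpolant I2 e2 f2 v2) =
    interpolant (I1 ∨̇ I2)
      (∨R (here refl) (∧R (there (there (there b))) (wk e1 ⊆-refl ⊆-pickSwap₁) (wk e2 ⊆-refl ⊆-pickSwap₂)))
      (∨L (here refl) (wk f1 (⊆-keep there) ⊆-refl) (wk f2 (⊆-keep there) ⊆-refl))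
      λ { n (∨l o) → map₁ (headOrTailR (vocabR b ∘ ∧l) id) (v1 n o)
        ; n (∨r o) → map₁ (headOrTailR (vocabR b ∘ ∧r) id) (v2 n o) }

  split∧R₂ : ∀ {A B} → (A ∧̇ B) ∈ Δ2 →
    Interpolant L Γ1 Δ1 Γ2 (A ∷ Δ2) → Interpolant L Γ1 Δ1 Γ2 (B ∷ Δ2) → Interpolant L Γ1 Δ1 Γ2 Δ2
  split∧R₂ b (interpolant I1 e1 f1 v1) (interpolant I2 e2 f2 v2) =
    interpolant (I1 ∧̇ I2)
      (∧R (here refl) (wk e1 ⊆-refl (⊆-keep there)) (wk e2 ⊆-refl (⊆-keep there)))
      (∧L (here refl) (∧R b (wk f1 ⊆-pick₁ ⊆-refl) (wk f2 ⊆-pick₂ ⊆-refl)))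
      λ { n (∧l o) → map₂ (headOrTailR (vocabR b ∘ ∧l) id) (v1 n o)
        ; n (∧r o) → map₂ (headOrTailR (vocabR b ∘ ∧r) id) (v2 n o) }

  split∨L₁ : ∀ {A B} → (A ∨̇ B) ∈ Γ1 →
    Interpolant L (A ∷ Γ1) Δ1 Γ2 Δ2 → Interpolant L (B ∷ Γ1) Δ1 Γ2 Δ2 → Interpolant L Γ1 Δ1 Γ2 Δ2
  split∨L₁ a (interpolant I1 e1 f1 v1) (interpolant I2 e2 f2 v2) =
    interpolant (I1 ∨̇ I2)
      (∨R (here refl) (∨L a (wk e1 ⊆-refl ⊆-pick₁) (wk e2 ⊆-refl ⊆-pick₂)))
      (∨L (here refl) (wk f1 (⊆-keep there) ⊆-refl) (wk f2 (⊆-keep there) ⊆-refl))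
      λ { n (∨l o) → map₁ (headOrTailL (vocabL a ∘ ∨l) id) (v1 n o)
        ; n (∨r o) → map₁ (headOrTailL (vocabL a ∘ ∨r) id) (v2 n o) }

  split∨L₂ : ∀ {A B} → (A ∨̇ B) ∈ Γ2 →
    Interpolant L Γ1 Δ1 (A ∷ Γ2) Δ2 → Interpolant L Γ1 Δ1 (B ∷ Γ2) Δ2 → Interpolant L Γ1 Δ1 Γ2 Δ2
  split∨L₂ a (interpolant I1 e1 f1 v1) (interpolant I2 e2 f2 v2) =
    interpolant (I1 ∧̇ I2)
      (∧R (here refl) (wk e1 ⊆-refl (⊆-keep there)) (wk e2 ⊆-refl (⊆-keep there)))
      (∧L (here refl) (∨L (there (there (there a))) (wk f1 ⊆-pickSwap₁ ⊆-refl) (wk f2 ⊆-pickSwap₂ ⊆-refl)))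
      λ { n (∧l o) → map₂ (headOrTailL (vocabL a ∘ ∨l) id) (v1 n o)
        ; n (∧r o) → map₂ (headOrTailL (vocabL a ∘ ∨r) id) (v2 n o) }

  split∨R₁ : ∀ {A B} → (A ∨̇ B) ∈ Δ1 → Interpolant L Γ1 (A ∷ B ∷ Δ1) Γ2 Δ2 → Interpolant L Γ1 Δ1 Γ2 Δ2
  split∨R₁ b (interpolant I e f v) =
    interpolant I (∨R (there b) (wk e ⊆-refl ⊆-rotate)) f
      (λ n o → map₁ (headOrTailR (vocabR b ∘ ∨l) (headOrTailR (vocabR b ∘ ∨r) id)) (v n o))

  split∨R₂ : ∀ {A B} → (A ∨̇ B) ∈ Δ2 → Interpolant L Γ1 Δ1 Γ2 (A ∷ B ∷ Δ2) → Interpolant L Γ1 Δ1 Γ2 Δ2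
  split∨R₂ b (interpolant I e f v) =
    interpolant I e (∨R b f)
      (λ n o → map₂ (headOrTailR (vocabR b ∘ ∨l) (headOrTailR (vocabR b ∘ ∨r) id)) (v n o))

  split⊃L₁ : ∀ {A B} → (A ⊃ B) ∈ Γ1 →
    Interpolant L Γ1 (A ∷ Δ1) Γ2 Δ2 → Interpolant L (B ∷ Γ1) Δ1 Γ2 Δ2 → Interpolant L Γ1 Δ1 Γ2 Δ2
  split⊃L₁ a (interpolant I1 e1 f1 v1) (interpolant I2 e2 f2 v2) =
    interpolant (I1 ∨̇ I2)
      (∨R (here refl) (⊃L a (wk e1 ⊆-refl ⊆-pickSwap₁) (wk e2 ⊆-refl ⊆-pick₂)))
      (∨L (here refl) (wk f1 (⊆-keep there) ⊆-refl) (wk f2 (⊆-keep there) ⊆-refl))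
      λ { n (∨l o) → map₁ (headOrTailR (vocabL a ∘ ⊃l) id) (v1 n o)
        ; n (∨r o) → map₁ (headOrTailL (vocabL a ∘ ⊃r) id) (v2 n o) }

  split⊃L₂ : ∀ {A B} → (A ⊃ B) ∈ Γ2 →
    Interpolant L Γ1 Δ1 Γ2 (A ∷ Δ2) → Interpolant L Γ1 Δ1 (B ∷ Γ2) Δ2 → Interpolant L Γ1 Δ1 Γ2 Δ2
  split⊃L₂ a (interpolant I1 e1 f1 v1) (interpolant I2 e2 f2 v2) =
    interpolant (I1 ∧̇ I2)
      (∧R (here refl) (wk e1 ⊆-refl (⊆-keep there)) (wk e2 ⊆-refl (⊆-keep there)))
      (∧L (here refl) (⊃L (there (there (there a))) (wk f1 ⊆-pick₁ ⊆-refl) (wk f2 ⊆-pickSwap₂ ⊆-refl)))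
      λ { n (∧l o) → map₂ (headOrTailR (vocabL a ∘ ⊃l) id) (v1 n o)
        ; n (∧r o) → map₂ (headOrTailL (vocabL a ∘ ⊃r) id) (v2 n o) }

  split⊃R₁ : ∀ {A B} → (A ⊃ B) ∈ Δ1 → Interpolant L (A ∷ Γ1) (B ∷ Δ1) Γ2 Δ2 → Interpolant L Γ1 Δ1 Γ2 Δ2
  split⊃R₁ b (interpolant I e f v) =
    interpolant I (⊃R (there b) (wk e ⊆-refl ⊆-swap)) f
      (λ n o → map₁ (headOrTailL (vocabR b ∘ ⊃l) (headOrTailR (vocabR b ∘ ⊃r) id)) (v n o))

  split⊃R₂ : ∀ {A B} → (A ⊃ B) ∈ Δ2 → Interpolant L Γ1 Δ1 (A ∷ Γ2) (B ∷ Δ2) → Interpolant L Γ1 Δ1 Γ2 Δ2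
  split⊃R₂ b (interpolant I e f v) =
    interpolant I e (⊃R b (wk f ⊆-swap ⊆-refl))
      (λ n o → map₂ (headOrTailL (vocabR b ∘ ⊃l) (headOrTailR (vocabR b ∘ ⊃r) id)) (v n o))

vocab-left : ∀ {n A} → InVocab n (A ∷ []) [] → Occurs n A
vocab-left (inj₁ (here o)) = o
vocab-left (inj₁ (there ()))
vocab-left (inj₂ ())

vocab-right : ∀ {n B} → InVocab n [] (B ∷ []) → Occurs n B
vocab-right (inj₂ (here o)) = o
vocab-right (inj₂ (there ()))
vocab-right (inj₁ ())

vocab-boxed : ∀ {n S} → InVocab n S [] → Any (Occurs n) S
vocab-boxed (inj₁ x) = x
vocab-boxed (inj₂ ())

boxedVocab : ∀ {n Γ S} → Boxed Γ S → Any (Occurs n) S → Any (Occurs n) Γ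
boxedVocab (m ∷ al) (here o) = lose m (in□ o)
boxedVocab (m ∷ al) (there x) = boxedVocab al x

splitBoxed : ∀ {Γ Γ1 Γ2 As} → Boxed Γ As → Partition Γ Γ1 Γ2 →
  Σ (List Fm) λ S1 → Σ (List Fm) λ S2 → Boxed Γ1 S1 × Boxed Γ2 S2 ×
    Partition As S1 S2 × (NonEmpty As → NonEmpty S1 ⊎ NonEmpty S2)
splitBoxed [] sg = [] , [] , [] , [] , (λ ()) , (λ ())
splitBoxed (_∷_ {a} m al) sg with sg m | splitBoxed al sg
... | inj₁ m1 | S1 , S2 , a1 , a2 , f , g =
  (a ∷ S1) , S2 , (m1 ∷ a1) , a2 , (λ { (here r) → inj₁ (here r) ; (there x) → Sum.map there id (f x) }) , (λ _ → inj₁ nonEmpty)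
... | inj₂ m2 | S1 , S2 , a1 , a2 , f , g =
  S1 , (a ∷ S2) , a1 , (m2 ∷ a2) , (λ { (here r) → inj₂ (here r) ; (there x) → Sum.map id there (f x) }) , (λ _ → inj₂ nonEmpty)

-- The interpolant J of
-- the premise (split accordingly) becomes □J when the box stays on the same side, and ¬□J or
-- ¬□¬J when the roles of the sides are exchanged.
module _ {L : Logic} {Γ1 Δ1 Γ2 Δ2 : List Fm} where
  splitE₁₂ : ∀ {A B} → has M L ≡ false → □ A ∈ Γ1 → □ B ∈ Δ2 → L ⊩ B ∷ [] ⇒ A ∷ [] →
    Interpolant L (A ∷ []) [] [] (B ∷ []) → Interpolant L Γ1 Δ1 Γ2 Δ2
  splitE₁₂ {A} {B} e a b q (interpolant J A⇒J J⇒B vc) =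
    interpolant (□ J) (mod (rE e a (here refl) A⇒J J⇒A)) (mod (rE e (here refl) b J⇒B B⇒J))
      λ { n (in□ o) → vocabL a (in□ (vocab-left (proj₁ (vc n o)))) , vocabR b (in□ (vocab-right (proj₂ (vc n o)))) }
    where
    J⇒A = cutAdmissible B J⇒B q ⊆-refl ⊆-head ⊆-head ⊆-refl
    B⇒J = cutAdmissible A q A⇒J ⊆-refl ⊆-head ⊆-head ⊆-refl

  -- For E the premises A ⇒ B and B ⇒ A are recovered from the interpolant by cut.
  splitE₂₁ : ∀ {A B} → has M L ≡ false → □ A ∈ Γ2 → □ B ∈ Δ1 → L ⊩ A ∷ [] ⇒ B ∷ [] →
    Interpolant L (B ∷ []) [] [] (A ∷ []) → Interpolant L Γ1 Δ1 Γ2 Δ2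
  splitE₂₁ {A} {B} e a b p (interpolant J B⇒J J⇒A vc) =
    interpolant (¬̇ □ J) (⊃R (here refl) (mod (rE e (here refl) (there (there b)) J⇒B B⇒J)))
      (⊃L (here refl) (mod (rE e (there a) (here refl) A⇒J J⇒A)) (ax⊥ (here refl)))
      λ { n (⊃l (in□ o)) → vocabR b (in□ (vocab-left (proj₁ (vc n o)))) , vocabL a (in□ (vocab-right (proj₂ (vc n o)))) ; n (⊃r ()) }
    where
    J⇒B = cutAdmissible A J⇒A p ⊆-refl ⊆-head ⊆-head ⊆-refl
    A⇒J = cutAdmissible B p B⇒J ⊆-refl ⊆-head ⊆-head ⊆-refl

  splitM₁₂ : ∀ {A B} → has M L ≡ true → has C L ≡ false → □ A ∈ Γ1 → □ B ∈ Δ2 →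
    Interpolant L (A ∷ []) [] [] (B ∷ []) → Interpolant L Γ1 Δ1 Γ2 Δ2
  splitM₁₂ e c a b (interpolant J A⇒J J⇒B vc) =
    interpolant (□ J) (mod (rM e c a (here refl) A⇒J)) (mod (rM e c (here refl) b J⇒B))
      λ { n (in□ o) → vocabL a (in□ (vocab-left (proj₁ (vc n o)))) , vocabR b (in□ (vocab-right (proj₂ (vc n o)))) }

  splitM₂₁ : ∀ {A B} → has M L ≡ true → has C L ≡ false → □ A ∈ Γ2 → □ B ∈ Δ1 →
    Interpolant L [] (B ∷ []) (A ∷ []) [] → Interpolant L Γ1 Δ1 Γ2 Δ2
  splitM₂₁ e c a b (interpolant J d1 d2 vc) =
    interpolant (¬̇ □ (¬̇ J)) (⊃R (here refl) (mod (rM e c (here refl) (there (there b)) ¬J⇒B)))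
      (⊃L (here refl) (mod (rM e c (there a) (here refl) A⇒¬J)) (ax⊥ (here refl)))
      λ { n (⊃l (in□ (⊃l o))) → vocabR b (in□ (vocab-right (proj₁ (vc n o)))) , vocabL a (in□ (vocab-left (proj₂ (vc n o))))
        ; n (⊃l (in□ (⊃r ()))) ; n (⊃r ()) }
    where
    ¬J⇒B = ⊃L (here refl) (wk d1 ⊆-[] ⊆-refl) (ax⊥ (here refl))
    A⇒¬J = ⊃R (here refl) (wk d2 ⊆-refl ⊆-[])

  -- D◇ without M: the E-rule on the first side, D◇ on the second.
  splitDE₁₂ : ∀ {A B} → has D◇ L ≡ true → has M L ≡ false → □ A ∈ Γ1 → □ B ∈ Γ2 → L ⊩ [] ⇒ A ∷ B ∷ [] →
    Interpolant L (A ∷ []) [] (B ∷ []) [] → Interpolant L Γ1 Δ1 Γ2 Δ2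
  splitDE₁₂ {A} {B} d e a b p (interpolant J d1 d2 vc) =
    interpolant (□ J) (mod (rE e a (here refl) d1 J⇒A)) (mod (rDE d e (here refl) (there b) ⇒J,B d2))
      λ { n (in□ o) → vocabL a (in□ (vocab-left (proj₁ (vc n o)))) , vocabL b (in□ (vocab-left (proj₂ (vc n o)))) }
    where
    J⇒A = cutAdmissible B p d2 ⊆-[] ⊆-swap ⊆-swap ⊆-[]
    ⇒J,B = cutAdmissible A p d1 ⊆-[] ⊆-head ⊆-skipMiddle ⊆-head

  splitDE₂₁ : ∀ {A B} → has D◇ L ≡ true → has M L ≡ false → □ A ∈ Γ2 → □ B ∈ Γ1 → L ⊩ [] ⇒ A ∷ B ∷ [] →
    Interpolant L (B ∷ []) [] (A ∷ []) [] → Interpolant L Γ1 Δ1 Γ2 Δ2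
  splitDE₂₁ {A} {B} d e a b p (interpolant J d1 d2 vc) =
    interpolant (□ J) (mod (rE e b (here refl) d1 J⇒B)) (mod (rDE d e (there a) (here refl) ⇒A,J (wk d2 ⊆-swap ⊆-refl)))
      λ { n (in□ o) → vocabL b (in□ (vocab-left (proj₁ (vc n o)))) , vocabL a (in□ (vocab-left (proj₂ (vc n o)))) }
    where
    J⇒B = cutAdmissible A p d2 ⊆-[] ⊆-swap ⊆-refl ⊆-[]
    ⇒A,J = cutAdmissible B p d1 ⊆-[] ⊆-head ⊆-swapPrefix ⊆-second

  splitDM₁₂ : ∀ {A B} → has D◇ L ≡ true → has M L ≡ true → has C L ≡ false → □ A ∈ Γ1 → □ B ∈ Γ2 →
    Interpolant L (A ∷ []) [] (B ∷ []) [] → Interpolant L Γ1 Δ1 Γ2 Δ2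
  splitDM₁₂ d e c a b (interpolant J d1 d2 vc) =
    interpolant (□ J) (mod (rM e c a (here refl) d1)) (mod (rDM d e c (here refl) (there b) d2))
      λ { n (in□ o) → vocabL a (in□ (vocab-left (proj₁ (vc n o)))) , vocabL b (in□ (vocab-left (proj₂ (vc n o)))) }

  splitDM₂₁ : ∀ {A B} → has D◇ L ≡ true → has M L ≡ true → has C L ≡ false → □ A ∈ Γ2 → □ B ∈ Γ1 →
    Interpolant L (B ∷ []) [] (A ∷ []) [] → Interpolant L Γ1 Δ1 Γ2 Δ2
  splitDM₂₁ d e c a b (interpolant J d1 d2 vc) =
    interpolant (□ J) (mod (rM e c b (here refl) d1)) (mod (rDM d e c (there a) (here refl) (wk d2 ⊆-swap ⊆-refl)))
      λ { n (in□ o) → vocabL b (in□ (vocab-left (proj₁ (vc n o)))) , vocabL a (in□ (vocab-left (proj₂ (vc n o)))) }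

  -- MC with □B on the second side; the first side may have no premises at all, when ⊤ works.
  splitC₂ : ∀ {B} → has C L ≡ true → □ B ∈ Δ2 → (S1 S2 : List Fm) → Boxed Γ1 S1 → Boxed Γ2 S2 →
    (has N L ≡ true ⊎ NonEmpty (S1 ++ S2)) → Interpolant L S1 [] S2 (B ∷ []) → Interpolant L Γ1 Δ1 Γ2 Δ2
  splitC₂ c b [] S2 a1 a2 ok (interpolant J e1 f1 v) =
    interpolant⊤ (mod (rC S2 c ok a2 b (cutAdmissible J e1 f1 ⊆-[] ⊆-refl ⊆-head ⊆-refl)))
  splitC₂ c b (x ∷ xs) S2 a1 a2 ok (interpolant J e1 f1 v) =
    interpolant (□ J)
      (mod (rC (x ∷ xs) c (inj₂ nonEmpty) a1 (here refl) e1))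
      (mod (rC (J ∷ S2) c (inj₂ nonEmpty) (here refl ∷ All.map there a2) b f1))
      λ { n (in□ o) → inj₁ (boxedVocab a1 (vocab-boxed (proj₁ (v n o)))) , secondSide (proj₂ (v n o)) }
    where
    secondSide : ∀ {n} → InVocab n S2 (_ ∷ []) → InVocab n Γ2 Δ2
    secondSide (inj₁ y) = inj₁ (boxedVocab a2 y)
    secondSide (inj₂ (here o)) = vocabR b (in□ o)
    secondSide (inj₂ (there ()))

  -- MC with □B on the first side; here the second side has to be nonempty for ¬□¬J.
  splitC₁ : ∀ {B} → has C L ≡ true → □ B ∈ Δ1 → (S1 S2 : List Fm) → Boxed Γ1 S1 → Boxed Γ2 S2 →
    (has N L ≡ true ⊎ NonEmpty (S2 ++ S1)) → Interpolant L S1 (B ∷ []) S2 [] → Interpolant L Γ1 Δ1 Γ2 Δ2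
  splitC₁ c b S1 [] a1 a2 ok (interpolant J e1 f1 v) =
    interpolant⊥ (mod (rC S1 c ok a1 b (cutAdmissible J e1 f1 ⊆-refl ⊆-head ⊆-refl ⊆-[])))
  splitC₁ c b S1 (x ∷ xs) a1 a2 ok (interpolant J e1 f1 v) =
    interpolant (¬̇ □ (¬̇ J))
      (⊃R (here refl) (mod (rC (¬̇ J ∷ S1) c (inj₂ nonEmpty) (here refl ∷ All.map there a1) (there (there b))
         (⊃L (here refl) (wk e1 there ⊆-refl) (ax⊥ (here refl))))))
      (⊃L (here refl) (mod (rC (x ∷ xs) c (inj₂ nonEmpty) (All.map there a2) (here refl)
                                (⊃R (here refl) (wk f1 ⊆-refl ⊆-[]))))
                      (ax⊥ (here refl)))
      λ { n (⊃l (in□ (⊃l o))) → firstSide (proj₁ (v n o)) , inj₁ (boxedVocab a2 (vocab-boxed (proj₂ (v n o))))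
        ; n (⊃l (in□ (⊃r ()))) ; n (⊃r ()) }
    where
    firstSide : ∀ {n} → InVocab n S1 (_ ∷ []) → InVocab n Γ1 Δ1
    firstSide (inj₁ y) = inj₁ (boxedVocab a1 y)
    firstSide (inj₂ (here o)) = vocabR b (in□ o)
    firstSide (inj₂ (there ()))

  splitCD : has C L ≡ true → has D⊥ L ≡ true → (S1 S2 : List Fm) → Boxed Γ1 S1 → Boxed Γ2 S2 →
    Interpolant L S1 [] S2 [] → Interpolant L Γ1 Δ1 Γ2 Δ2
  splitCD c d S1 [] a1 a2 (interpolant J e1 f1 v) =
    interpolant⊥ (deonticC c d S1 a1 (cutAdmissible J e1 f1 ⊆-refl ⊆-head ⊆-head ⊆-[]))
  splitCD c d S1 (x ∷ xs) a1 a2 (interpolant J e1 f1 v) =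
    interpolant (¬̇ □ (¬̇ J))
      (⊃R (here refl) (deonticC c d (¬̇ J ∷ S1) (here refl ∷ All.map there a1)
                                   (⊃L (here refl) (wk e1 there ⊆-refl) (ax⊥ (here refl)))))
      (⊃L (here refl) (mod (rC (x ∷ xs) c (inj₂ nonEmpty) (All.map there a2) (here refl)
                                (⊃R (here refl) (wk f1 ⊆-refl ⊆-[]))))
                      (ax⊥ (here refl)))
      λ { n (⊃l (in□ (⊃l o))) → inj₁ (boxedVocab a1 (vocab-boxed (proj₁ (v n o))))
                               , inj₁ (boxedVocab a2 (vocab-boxed (proj₂ (v n o))))
        ; n (⊃l (in□ (⊃r ()))) ; n (⊃r ()) }

nonEmpty++ : ∀ (S1 S2 : List Fm) → NonEmpty S1 ⊎ NonEmpty S2 → NonEmpty (S1 ++ S2)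
nonEmpty++ [] S2 (inj₂ n) = n
nonEmpty++ [] S2 (inj₁ ())
nonEmpty++ (x ∷ xs) S2 _ = nonEmpty

allowedSplit : ∀ {L} {As : List Fm} (S1 S2 : List Fm) → (has N L ≡ true ⊎ NonEmpty As) →
  (NonEmpty As → NonEmpty S1 ⊎ NonEmpty S2) → has N L ≡ true ⊎ NonEmpty (S1 ++ S2)
allowedSplit S1 S2 (inj₁ n) g = inj₁ n
allowedSplit S1 S2 (inj₂ n) g = inj₂ (nonEmpty++ S1 S2 (g n))

maehara : ∀ {L Γ Δ Γ1 Δ1 Γ2 Δ2} → L ⊩ Γ ⇒ Δ →
  Partition Γ Γ1 Γ2 → Partition Δ Δ1 Δ2 → Interpolant L Γ1 Δ1 Γ2 Δ2
maeharaModal : ∀ {L Γ Δ Γ1 Δ1 Γ2 Δ2} → ModalRule L Γ Δ →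
  Partition Γ Γ1 Γ2 → Partition Δ Δ1 Δ2 → Interpolant L Γ1 Δ1 Γ2 Δ2

maehara-AB : ∀ {L A B} → L ⊩ A ∷ [] ⇒ B ∷ [] → Interpolant L (A ∷ []) [] [] (B ∷ [])
maehara-AB p =
  maehara p (λ { (here r) → inj₁ (here r) ; (there ()) }) (λ { (here r) → inj₂ (here r) ; (there ()) })
maehara-BA : ∀ {L A B} → L ⊩ A ∷ [] ⇒ B ∷ [] → Interpolant L [] (B ∷ []) (A ∷ []) []
maehara-BA p =
  maehara p (λ { (here r) → inj₂ (here r) ; (there ()) }) (λ { (here r) → inj₁ (here r) ; (there ()) })
maehara-A|B : ∀ {L A B} → L ⊩ A ∷ B ∷ [] ⇒ [] → Interpolant L (A ∷ []) [] (B ∷ []) []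
maehara-A|B p =
  maehara p (λ { (here r) → inj₁ (here r) ; (there (here r)) → inj₂ (here r) ; (there (there ())) }) (λ ())
maehara-B|A : ∀ {L A B} → L ⊩ A ∷ B ∷ [] ⇒ [] → Interpolant L (B ∷ []) [] (A ∷ []) []
maehara-B|A p =
  maehara p (λ { (here r) → inj₂ (here r) ; (there (here r)) → inj₁ (here r) ; (there (there ())) }) (λ ())

maehara (ax m1 m2) sg sd with sg m1 | sd m2
... | inj₁ a | inj₁ b = interpolant⊥ (ax a b)
... | inj₂ a | inj₂ b = interpolant⊤ (ax a b)
... | inj₁ a | inj₂ b =
    interpolant (var _) (ax a (here refl)) (ax (here refl) b) (λ { n here → vocabL a here , vocabR b here })
... | inj₂ a | inj₁ b = interpolant (¬̇ var _) (⊃R (here refl) (ax (here refl) (there (there b))))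
       (⊃L (here refl) (ax (there a) (here refl)) (ax⊥ (here refl)))
       (λ { n (⊃l here) → vocabR b here , vocabL a here ; n (⊃r ()) })
maehara (ax⊥ m) sg sd with sg m
... | inj₁ a = interpolant⊥ (ax⊥ a)
... | inj₂ a = interpolant⊤ (ax⊥ a)
maehara (∧L m p) sg sd with sg m
... | inj₁ a = split∧L₁ a (maehara p (toFirst (toFirst sg)) sd)
... | inj₂ a = split∧L₂ a (maehara p (toSecond (toSecond sg)) sd)
maehara (∧R m p q) sg sd with sd m
... | inj₁ b = split∧R₁ b (maehara p sg (toFirst sd)) (maehara q sg (toFirst sd))
... | inj₂ b = split∧R₂ b (maehara p sg (toSecond sd)) (maehara q sg (toSecond sd))
maehara (∨L m p q) sg sd with sg m
... | inj₁ a = split∨L₁ a (maehara p (toFirst sg) sd) (maehara q (toFirst sg) sd)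
... | inj₂ a = split∨L₂ a (maehara p (toSecond sg) sd) (maehara q (toSecond sg) sd)
maehara (∨R m p) sg sd with sd m
... | inj₁ b = split∨R₁ b (maehara p sg (toFirst (toFirst sd)))
... | inj₂ b = split∨R₂ b (maehara p sg (toSecond (toSecond sd)))
maehara (⊃L m p q) sg sd with sg m
... | inj₁ a = split⊃L₁ a (maehara p sg (toFirst sd)) (maehara q (toFirst sg) sd)
... | inj₂ a = split⊃L₂ a (maehara p sg (toSecond sd)) (maehara q (toSecond sg) sd)
maehara (⊃R m p) sg sd with sd m
... | inj₁ b = split⊃R₁ b (maehara p (toFirst sg) (toFirst sd))
... | inj₂ b = split⊃R₂ b (maehara p (toSecond sg) (toSecond sd))
maehara (mod r) sg sd = maeharaModal r sg sd

maeharaModal (rE e m1 m2 p q) sg sd with sg m1 | sd m2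
... | inj₁ a | inj₁ b = interpolant⊥ (mod (rE e a b p q))
... | inj₂ a | inj₂ b = interpolant⊤ (mod (rE e a b p q))
... | inj₁ a | inj₂ b = splitE₁₂ e a b q (maehara-AB p)
... | inj₂ a | inj₁ b = splitE₂₁ e a b p (maehara-AB q)
maeharaModal (rM e c m1 m2 p) sg sd with sg m1 | sd m2
... | inj₁ a | inj₁ b = interpolant⊥ (mod (rM e c a b p))
... | inj₂ a | inj₂ b = interpolant⊤ (mod (rM e c a b p))
... | inj₁ a | inj₂ b = splitM₁₂ e c a b (maehara-AB p)
... | inj₂ a | inj₁ b = splitM₂₁ e c a b (maehara-BA p)
maeharaModal (rN n c m2 p) sg sd with sd m2
... | inj₁ b = interpolant⊥ (mod (rN n c b p))
... | inj₂ b = interpolant⊤ (mod (rN n c b p))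
maeharaModal (rD d c m1 p) sg sd with sg m1
... | inj₁ a = interpolant⊥ (mod (rD d c a p))
... | inj₂ a = interpolant⊤ (mod (rD d c a p))
maeharaModal (rDE d e m1 m2 p q) sg sd with sg m1 | sg m2
... | inj₁ a | inj₁ b = interpolant⊥ (mod (rDE d e a b p q))
... | inj₂ a | inj₂ b = interpolant⊤ (mod (rDE d e a b p q))
... | inj₁ a | inj₂ b = splitDE₁₂ d e a b p (maehara-A|B q)
... | inj₂ a | inj₁ b = splitDE₂₁ d e a b p (maehara-B|A q)
maeharaModal (rDM d e c m1 m2 q) sg sd with sg m1 | sg m2
... | inj₁ a | inj₁ b = interpolant⊥ (mod (rDM d e c a b q))
... | inj₂ a | inj₂ b = interpolant⊤ (mod (rDM d e c a b q))
... | inj₁ a | inj₂ b = splitDM₁₂ d e c a b (maehara-A|B q)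
... | inj₂ a | inj₁ b = splitDM₂₁ d e c a b (maehara-B|A q)
maeharaModal {L} (rC {B = B} As c ok al m2 p) sg sd with splitBoxed al sg | sd m2
... | S1 , S2 , a1 , a2 , f , g | inj₂ b =
  splitC₂ c b S1 S2 a1 a2 (allowedSplit {L} S1 S2 ok g)
    (maehara {Δ1 = []} {Δ2 = B ∷ []} p f (λ { (here r) → inj₂ (here r) ; (there ()) }))
... | S1 , S2 , a1 , a2 , f , g | inj₁ b =
  splitC₁ c b S1 S2 a1 a2 (allowedSplit {L} S2 S1 ok (Sum.swap ∘ g))
    (maehara {Δ1 = B ∷ []} {Δ2 = []} p f (λ { (here r) → inj₁ (here r) ; (there ()) }))
maeharaModal (rCD As c d n al p) sg sd with splitBoxed al sg
... | S1 , S2 , a1 , a2 , f , g = splitCD c d S1 S2 a1 a2 (maehara {Δ1 = []} {Δ2 = []} p f (λ ()))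


theorem7 : (X : Logic) (A B : Fm) → X ⊢ (A ⊃ B) →
    Σ Fm (λ I → (∀ (n : ℕ) → Occurs n I → Occurs n A × Occurs n B)
    × (X ⊢ (A ⊃ I)) × (X ⊢ (I ⊃ B)))
theorem7 X A B h = I , sharedVars , singleSequent (soundness left) , singleSequent (soundness right)
  where
  open Interpolant (maehara-AB (implicationSequent (completeness h)))
  sharedVars : ∀ n → Occurs n I → Occurs n A × Occurs n B
  sharedVars n o = vocab-left (proj₁ (shared n o)) , vocab-right (proj₂ (shared n o))
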